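{- For all positive integers $j,k,r$, the formal power series $\sum_{n\ge0}\mathrm{NCN}^{Matching}_{j,k}(n,r)x^n$ is rational, where $\mathrm{NCN}^{Matching}_{j,k}(n,r)$ is the number of $r$-colored matchings $M$ of $[n]$ with $\mathrm{cr}(M)<j$ and $\mathrm{ne}(M)<k$.
   Context: For a partition $P$ of $[n]=\{1,\dots,n\}$, $\mathrm{Arc}(P)$ is the set of pairs $(i,j)$ with $i,j$ in the same block and $j$ the least element of that block greater than $i$. A $k$-crossing is a sequence of arcs with $i_1<\dots<i_k<j_1<\dots<j_k$, a $k$-nesting one with $i_1<\dots<i_k<j_k<\dots<j_1$. An $r$-colored partition is $\Lambda=(P,\varphi)$ with $\varphi:\mathrm{Arc}(P)\to[r]$; $\mathrm{cr}(\Lambda)$ ($\mathrm{ne}(\Lambda)$) is the largest $k$ such that $P$ has a $k$-crossing ($k$-nesting) whose arcs all have the same color. An $r$-colored matching is an $r$-colored partition all of whose blocks have size $1$ or $2$. A power series is rational if it equals $P/Q$ for polynomials $P,Q$ with $Q(0)\ne0$. -}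

module Defs where

open import Data.Nat using (ℕ; zero; suc; _<_; _∸_)
open import Data.Fin using (Fin; toℕ; fromℕ) renaming (zero to fzero)
open import Data.Vec using (Vec; lookup)
open import Data.Maybe using (Maybe; just; nothing)
open import Data.List using (List; []; _∷_; length)
open import Data.List.Relation.Unary.Unique.Propositional using (Unique)
open import Data.List.Membership.Propositional using (_∈_)
open import Data.Product using (Σ; ∃; _×_; _,_)
open import Data.Integer using (+_)
open import Data.Rational using (ℚ; 0ℚ; _+_; _*_; _/_)
open import Relation.Binary.PropositionalEquality using (_≡_)
open import Relation.Nullary using (¬_)

-- A matching is encoded by its involution σ (σ i = partner of i, or i if
-- {i} is a singleton block).  Its arcs are the pairs (i , σ i) with i < σ i.
-- The coloring stores at each position i the color of the arc starting at
-- i (just col) when i is the left end of an arc, and nothing otherwise.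

ColoredMatchingData : ℕ → ℕ → Set
ColoredMatchingData n r = Vec (Fin n) n × Vec (Maybe (Fin r)) n

_<ᶠ_ : ∀ {n} → Fin n → Fin n → Set
a <ᶠ b = toℕ a < toℕ b

IsColoredMatching : ∀ {n r} → ColoredMatchingData n r → Set
IsColoredMatching {n} {r} (σ , c) =
  (∀ i → lookup σ (lookup σ i) ≡ i) ×
  (∀ i → i <ᶠ lookup σ i → Σ (Fin r) λ col → lookup c i ≡ just col) ×
  (∀ i → ¬ (i <ᶠ lookup σ i) → lookup c i ≡ nothing)

MonoCrossing : ∀ {n r} → ColoredMatchingData n r → ℕ → Set
MonoCrossing {n} {r} (σ , c) m =
  Σ (Fin (suc m) → Fin n) λ f → Σ (Fin r) λ col →
    (∀ a → lookup c (f a) ≡ just col) ×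
    (∀ a b → a <ᶠ b → f a <ᶠ f b) ×
    (f (fromℕ m) <ᶠ lookup σ (f fzero)) ×
    (∀ a b → a <ᶠ b → lookup σ (f a) <ᶠ lookup σ (f b))

MonoNesting : ∀ {n r} → ColoredMatchingData n r → ℕ → Set
MonoNesting {n} {r} (σ , c) m =
  Σ (Fin (suc m) → Fin n) λ f → Σ (Fin r) λ col →
    (∀ a → lookup c (f a) ≡ just col) ×
    (∀ a b → a <ᶠ b → f a <ᶠ f b) ×
    (f (fromℕ m) <ᶠ lookup σ (f (fromℕ m))) ×
    (∀ a b → a <ᶠ b → lookup σ (f b) <ᶠ lookup σ (f a))

-- cr(M) < suc j' and ne(M) < suc k'  (i.e. no monochromatic (suc j')-crossing
-- and no monochromatic (suc k')-nesting).
NCNGood : ∀ {n r} → ℕ → ℕ → ColoredMatchingData n r → Set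
NCNGood j' k' M = IsColoredMatching M × ¬ MonoCrossing M j' × ¬ MonoNesting M k'

IsCount : {A : Set} → (A → Set) → ℕ → Set
IsCount {A} P m =
  Σ (List A) λ L → Unique L × (∀ x → x ∈ L → P x) × (∀ x → P x → x ∈ L) × length L ≡ m

ℕtoℚ : ℕ → ℚ
ℕtoℚ n = (+ n) / 1

coeff : List ℚ → ℕ → ℚ
coeff []       _       = 0ℚ
coeff (q ∷ _)  zero    = q
coeff (_ ∷ qs) (suc i) = coeff qs i

sumTo : ℕ → (ℕ → ℚ) → ℚ
sumTo zero    g = g zero
sumTo (suc m) g = sumTo m g + g (suc m)

convCoeff : List ℚ → (ℕ → ℕ) → ℕ → ℚ
convCoeff Q a n = sumTo n λ i → coeff Q i * ℕtoℚ (a (n ∸ i))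

-- Σ a(n) xⁿ = P/Q with Q(0) ≠ 0, i.e. Q · F = P.
IsRationalSeries : (ℕ → ℕ) → Set
IsRationalSeries a =
  Σ (List ℚ) λ P → Σ (List ℚ) λ Q →
    ¬ (coeff Q 0 ≡ 0ℚ) × (∀ n → convCoeff Q a n ≡ coeff P n)

-- A word over a finite alphabet generates a matching of [n] position by position: a letter
-- leaves the position single, or opens an arc of some colour and fixes its place in the order
-- in which the open arcs will be closed, or closes the first open arc in that order. All arcs
-- of a crossing or nesting are open at one moment, where they form a monochromatic increasing,
-- respectively decreasing, sequence of openers in closing order; so the forbidden patterns can
-- be read off the abstraction that lists the open arcs in closing order with their colours and
-- the ranks of their openers. By the Erdős–Szekeres argument a pattern-free matching never has
-- more than (r + 1)·ES(j, k) open arcs, so these abstractions are the states of a finite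
-- automaton whose accepted words of length n correspond bijectively to the matchings counted.
-- Word counts obey a linear recurrence given by the transfer matrix, and a linear dependence
-- among d + 1 state-count vectors in ℚᵈ turns it into a rational generating function.

module Submission where

open import Defs
open import Data.Nat using (ℕ; suc)
open import Data.Fin using (Fin) renaming (zero to fzero)

module RationalSeries where

  open import Data.Nat using (ℕ; zero; suc; pred; _<_; _≤_; z≤n; s≤s; _<?_; _≟_; _∸_)
    renaming (_+_ to _+ℕ_; _*_ to _*ℕ_)
  import Data.Nat.Properties as ℕ
  import Data.Integer as ℤ
  import Data.Integer.Properties as ℤ
  open import Data.Rational using (ℚ; 0ℚ; 1ℚ; _+_; _*_; -_; 1/_; ≢-nonZero; toℚᵘ)
  import Data.Rational.Properties as ℚ
  open import Data.Rational.Unnormalised using (ℚᵘ; mkℚᵘ; *≡*)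
  import Data.Rational.Unnormalised as ℚᵘ
  import Data.Rational.Unnormalised.Properties as ℚᵘ
  open import Data.Rational.Solver using (module +-*-Solver)
  open +-*-Solver
  open import Data.List using (List; applyUpTo)
  open import Data.Nat.ListAction using (sum)
  open import Data.Product using (Σ; _×_; _,_; proj₁; proj₂)
  open import Data.Sum using (_⊎_; inj₁; inj₂)
  open import Data.Empty using (⊥-elim)
  open import Function using (_∘_)
  open import Relation.Binary.PropositionalEquality
    using (_≡_; _≢_; refl; sym; trans; cong; cong₂; subst; module ≡-Reasoning)
  open import Relation.Nullary using (yes; no)

  private
    ι : ℕ → ℚᵘ
    ι k = mkℚᵘ (ℤ.+ k) 0

    ℕtoℚ≃ι : ∀ k → toℚᵘ (ℕtoℚ k) ℚᵘ.≃ ι k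
    ℕtoℚ≃ι k = ℚ.toℚᵘ-fromℚᵘ (ι k)

  ℕtoℚ-+ : ∀ m n → ℕtoℚ (m +ℕ n) ≡ ℕtoℚ m + ℕtoℚ n
  ℕtoℚ-+ m n = ℚ.toℚᵘ-injective (ℚᵘ.≃-sym (ℚᵘ.≃-trans (ℚ.toℚᵘ-homo-+ (ℕtoℚ m) (ℕtoℚ n))
    (ℚᵘ.≃-trans (ℚᵘ.+-cong (ℕtoℚ≃ι m) (ℕtoℚ≃ι n)) (ℚᵘ.≃-trans ι-+ (ℚᵘ.≃-sym (ℕtoℚ≃ι (m +ℕ n)))))))
    where
    ι-+ : (ι m ℚᵘ.+ ι n) ℚᵘ.≃ ι (m +ℕ n)
    ι-+ = *≡* (trans (ℤ.*-identityʳ _) (trans (cong₂ ℤ._+_ (ℤ.*-identityʳ (ℤ.+ m)) (ℤ.*-identityʳ (ℤ.+ n)))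
            (sym (trans (ℤ.*-identityʳ _) (ℤ.pos-+ m n)))))

  ℕtoℚ-* : ∀ m n → ℕtoℚ (m *ℕ n) ≡ ℕtoℚ m * ℕtoℚ n
  ℕtoℚ-* m n = ℚ.toℚᵘ-injective (ℚᵘ.≃-sym (ℚᵘ.≃-trans (ℚ.toℚᵘ-homo-* (ℕtoℚ m) (ℕtoℚ n))
    (ℚᵘ.≃-trans (ℚᵘ.*-cong (ℕtoℚ≃ι m) (ℕtoℚ≃ι n)) (ℚᵘ.≃-trans ι-* (ℚᵘ.≃-sym (ℕtoℚ≃ι (m *ℕ n)))))))
    where
    ι-* : (ι m ℚᵘ.* ι n) ℚᵘ.≃ ι (m *ℕ n)
    ι-* = *≡* (trans (ℤ.*-identityʳ _) (sym (trans (ℤ.*-identityʳ _) (ℤ.pos-* m n))))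

  Σ< : ℕ → (ℕ → ℚ) → ℚ
  Σ< zero    f = 0ℚ
  Σ< (suc m) f = Σ< m f + f m

  Σ<-cong : ∀ m {f g} → (∀ j → j < m → f j ≡ g j) → Σ< m f ≡ Σ< m g
  Σ<-cong zero    f≡g = refl
  Σ<-cong (suc m) f≡g = cong₂ _+_ (Σ<-cong m (λ j j<m → f≡g j (ℕ.m≤n⇒m≤1+n j<m))) (f≡g m ℕ.≤-refl)

  Σ<-vanish : ∀ m {f} → (∀ j → j < m → f j ≡ 0ℚ) → Σ< m f ≡ 0ℚ
  Σ<-vanish zero    f≡0 = refl
  Σ<-vanish (suc m) f≡0 =
    cong₂ _+_ (Σ<-vanish m (λ j j<m → f≡0 j (ℕ.m≤n⇒m≤1+n j<m))) (f≡0 m ℕ.≤-refl)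

  Σ<-+ : ∀ m f g → Σ< m (λ j → f j + g j) ≡ Σ< m f + Σ< m g
  Σ<-+ zero    f g = refl
  Σ<-+ (suc m) f g = trans (cong (_+ (f m + g m)) (Σ<-+ m f g))
    (solve 4 (λ a b c d → (a :+ b) :+ (c :+ d) := (a :+ c) :+ (b :+ d)) refl (Σ< m f) (Σ< m g) (f m) (g m))

  Σ<-*ˡ : ∀ m a f → Σ< m (λ j → a * f j) ≡ a * Σ< m f
  Σ<-*ˡ zero    a f = sym (ℚ.*-zeroʳ a)
  Σ<-*ˡ (suc m) a f = trans (cong (_+ a * f m) (Σ<-*ˡ m a f)) (sym (ℚ.*-distribˡ-+ a (Σ< m f) (f m)))

  Σ<-comm : ∀ m d (f : ℕ → ℕ → ℚ) → Σ< m (λ j → Σ< d (f j)) ≡ Σ< d (λ k → Σ< m (λ j → f j k))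
  Σ<-comm zero    d f = sym (Σ<-vanish d (λ _ _ → refl))
  Σ<-comm (suc m) d f = trans (cong (_+ Σ< d (f m)) (Σ<-comm m d f))
    (sym (Σ<-+ d (λ k → Σ< m (λ j → f j k)) (f m)))

  Σ<-head : ∀ m g → Σ< (suc m) g ≡ g 0 + Σ< m (g ∘ suc)
  Σ<-head zero    g = trans (ℚ.+-identityˡ (g 0)) (sym (ℚ.+-identityʳ (g 0)))
  Σ<-head (suc m) g = trans (cong (_+ g (suc m)) (Σ<-head m g)) (ℚ.+-assoc (g 0) _ _)

  Σ<-reverse : ∀ m f → Σ< m f ≡ Σ< m (λ t → f (m ∸ suc t))
  Σ<-reverse zero    f = refl
  Σ<-reverse (suc m) f = begin
    Σ< m f + f m                         ≡⟨ cong (_+ f m) (Σ<-reverse m f) ⟩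
    Σ< m (λ t → f (m ∸ suc t)) + f m     ≡⟨ ℚ.+-comm _ (f m) ⟩
    f m + Σ< m (λ t → f (m ∸ suc t))     ≡⟨ Σ<-head m (λ t → f (m ∸ t)) ⟨
    Σ< (suc m) (λ t → f (m ∸ t))         ∎
    where open ≡-Reasoning

  Σ<-truncate : ∀ m h f → h ≤ m → (∀ j → h ≤ j → j < m → f j ≡ 0ℚ) → Σ< m f ≡ Σ< h f
  Σ<-truncate zero    .zero f z≤n f≡0 = refl
  Σ<-truncate (suc m) h     f h≤ f≡0 with h ≟ suc m
  ... | yes refl = refl
  ... | no h≢ = trans (cong₂ _+_ (Σ<-truncate m h f h≤m (λ j h≤j j<m → f≡0 j h≤j (ℕ.m≤n⇒m≤1+n j<m)))
                                 (f≡0 m h≤m ℕ.≤-refl))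
                      (ℚ.+-identityʳ _)
    where h≤m = ℕ.≤-pred (ℕ.≤∧≢⇒< h≤ h≢)

  sumTo≡Σ< : ∀ m g → sumTo m g ≡ Σ< (suc m) g
  sumTo≡Σ< zero    g = sym (ℚ.+-identityˡ (g 0))
  sumTo≡Σ< (suc m) g = cong (_+ g (suc m)) (sumTo≡Σ< m g)

  ℕtoℚ-sum : ∀ m g → ℕtoℚ (sum (applyUpTo g m)) ≡ Σ< m (ℕtoℚ ∘ g)
  ℕtoℚ-sum zero    g = refl
  ℕtoℚ-sum (suc m) g = begin
    ℕtoℚ (g 0 +ℕ sum (applyUpTo (g ∘ suc) m))   ≡⟨ ℕtoℚ-+ (g 0) _ ⟩
    ℕtoℚ (g 0) + ℕtoℚ (sum (applyUpTo (g ∘ suc) m)) ≡⟨ cong (ℕtoℚ (g 0) +_) (ℕtoℚ-sum m (g ∘ suc)) ⟩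
    ℕtoℚ (g 0) + Σ< m (ℕtoℚ ∘ g ∘ suc)          ≡⟨ Σ<-head m (ℕtoℚ ∘ g) ⟨
    Σ< (suc m) (ℕtoℚ ∘ g)                        ∎
    where open ≡-Reasoning

  punchIn : ℕ → ℕ → ℕ
  punchIn p k with k <? p
  ... | yes _ = k
  ... | no  _ = suc k

  punchIn-< : ∀ {p m} k → p < suc m → k < m → punchIn p k < suc m
  punchIn-< {p} k p≤m k<m with k <? p
  ... | yes _ = ℕ.m≤n⇒m≤1+n k<m
  ... | no  _ = s≤s k<m

  punchIn≢ : ∀ p k → punchIn p k ≢ p
  punchIn≢ p k with k <? p
  ... | yes k<p = ℕ.<⇒≢ k<p
  ... | no  k≮p = λ k+1≡p → k≮p (subst (k <_) k+1≡p (ℕ.n<1+n k))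

  punchOut : ℕ → ℕ → ℕ
  punchOut p j with j <? p
  ... | yes _ = j
  ... | no  _ = pred j

  punchOut-punchIn : ∀ p k → punchOut p (punchIn p k) ≡ k
  punchOut-punchIn p k with k <? p
  punchOut-punchIn p k | yes k<p with k <? p
  ... | yes _   = refl
  ... | no  k≮p = ⊥-elim (k≮p k<p)
  punchOut-punchIn p k | no k≮p with suc k <? p
  ... | yes k+1<p = ⊥-elim (k≮p (ℕ.<-trans (ℕ.n<1+n k) k+1<p))
  ... | no  _     = refl

  Σ<-punchIn : ∀ m p g → p < suc m → Σ< (suc m) g ≡ g p + Σ< m (g ∘ punchIn p)
  Σ<-punchIn zero    zero    g _ = ℚ.+-comm 0ℚ (g 0)
  Σ<-punchIn zero    (suc p) g (s≤s ())
  Σ<-punchIn (suc m) p       g p≤m+1 with p ≟ suc m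
  ... | yes refl = trans (ℚ.+-comm (Σ< (suc m) g) (g (suc m)))
                         (cong (g (suc m) +_) (Σ<-cong (suc m) (λ k k<m+1 → cong g (sym (punchIn-below k k<m+1)))))
    where
    punchIn-below : ∀ k → k < suc m → punchIn (suc m) k ≡ k
    punchIn-below k k< with k <? suc m
    ... | yes _  = refl
    ... | no  k≮ = ⊥-elim (k≮ k<)
  ... | no p≢ = begin
    Σ< (suc m) g + g (suc m)                            ≡⟨ cong (_+ g (suc m)) (Σ<-punchIn m p g p≤m) ⟩
    (g p + Σ< m (g ∘ punchIn p)) + g (suc m)            ≡⟨ ℚ.+-assoc (g p) _ _ ⟩
    g p + (Σ< m (g ∘ punchIn p) + g (suc m))            ≡⟨ cong (λ z → g p + (Σ< m (g ∘ punchIn p) + g z)) punchIn-last ⟨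
    g p + Σ< (suc m) (g ∘ punchIn p)                    ∎
    where
    open ≡-Reasoning
    p≤m : p < suc m
    p≤m = ℕ.≤∧≢⇒< (ℕ.≤-pred p≤m+1) p≢
    punchIn-last : punchIn p m ≡ suc m
    punchIn-last with m <? p
    ... | yes m<p = ⊥-elim (ℕ.<-irrefl refl (ℕ.≤-trans p≤m m<p))
    ... | no  _   = refl

  *-≢0 : ∀ a b → a ≢ 0ℚ → b ≢ 0ℚ → a * b ≢ 0ℚ
  *-≢0 a b a≢0 b≢0 ab≡0 = b≢0 (begin
    b               ≡⟨ ℚ.*-identityˡ b ⟨
    1ℚ * b          ≡⟨ cong (_* b) (ℚ.*-inverseˡ a) ⟨
    (1/ a * a) * b  ≡⟨ ℚ.*-assoc (1/ a) a b ⟩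
    1/ a * (a * b)  ≡⟨ cong (1/ a *_) ab≡0 ⟩
    1/ a * 0ℚ       ≡⟨ ℚ.*-zeroʳ (1/ a) ⟩
    0ℚ              ∎)
    where
    open ≡-Reasoning
    instance _ = ≢-nonZero a≢0

  NonzeroBelow : ℕ → (ℕ → ℚ) → Set
  NonzeroBelow m c = Σ ℕ λ j → j < m × c j ≢ 0ℚ

  vanishing⊎nonzero : ∀ m (u : ℕ → ℚ) → (∀ j → j < m → u j ≡ 0ℚ) ⊎ NonzeroBelow m u
  vanishing⊎nonzero zero    u = inj₁ (λ j ())
  vanishing⊎nonzero (suc m) u with vanishing⊎nonzero m u
  ... | inj₂ (j , j<m , u≢0) = inj₂ (j , ℕ.m≤n⇒m≤1+n j<m , u≢0)
  ... | inj₁ u≡0 with u m ℚ.≟ 0ℚ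
  ...   | no  um≢0 = inj₂ (m , ℕ.≤-refl , um≢0)
  ...   | yes um≡0 = inj₁ vanish
    where
    vanish : ∀ j → j < suc m → u j ≡ 0ℚ
    vanish j j<m+1 with j ≟ m
    ... | yes refl = um≡0
    ... | no  j≢m  = u≡0 j (ℕ.≤∧≢⇒< (ℕ.≤-pred j<m+1) j≢m)

  -- u j i is the i-th coordinate of the j-th vector.
  Vanishes : ℕ → ℕ → (ℕ → ℕ → ℚ) → (ℕ → ℚ) → Set
  Vanishes d m u c = ∀ i → i < d → Σ< m (λ j → c j * u j i) ≡ 0ℚ

  -- One step of Gaussian elimination with pivot vector p: a combination c of the m vectors
  -- obtained by clearing coordinate 0 of the others against u p lifts to one of all suc m.
  module Pivot (m : ℕ) (u : ℕ → ℕ → ℚ) (p : ℕ) (p≤m : p < suc m) (α≢0 : u p 0 ≢ 0ℚ) where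

    α : ℚ
    α = u p 0

    cleared : ℕ → ℕ → ℚ
    cleared k i = α * u (punchIn p k) i + - (u (punchIn p k) 0 * u p i)

    lift : (ℕ → ℚ) → ℕ → ℚ
    lift c j with j ≟ p
    ... | yes _ = - Σ< m (λ k → c k * u (punchIn p k) 0)
    ... | no  _ = α * c (punchOut p j)

    lift-pivot : ∀ c → lift c p ≡ - Σ< m (λ k → c k * u (punchIn p k) 0)
    lift-pivot c with p ≟ p
    ... | yes _   = refl
    ... | no  p≢p = ⊥-elim (p≢p refl)

    lift-punchIn : ∀ c k → lift c (punchIn p k) ≡ α * c k
    lift-punchIn c k with punchIn p k ≟ p
    ... | yes eq = ⊥-elim (punchIn≢ p k eq)
    ... | no  _  = cong (λ z → α * c z) (punchOut-punchIn p k)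

    lift-nonzero : ∀ c → NonzeroBelow m c → NonzeroBelow (suc m) (lift c)
    lift-nonzero c (k , k<m , ck≢0) =
      punchIn p k , punchIn-< k p≤m k<m , λ eq → *-≢0 α (c k) α≢0 ck≢0 (trans (sym (lift-punchIn c k)) eq)

    lift-combination : ∀ c i → Σ< (suc m) (λ j → lift c j * u j i) ≡ Σ< m (λ k → c k * cleared k i)
    lift-combination c i = begin
      Σ< (suc m) (λ j → lift c j * u j i)
        ≡⟨ Σ<-punchIn m p (λ j → lift c j * u j i) p≤m ⟩
      lift c p * u p i + Σ< m (λ k → lift c (punchIn p k) * u (punchIn p k) i)
        ≡⟨ cong₂ _+_ (cong (_* u p i) (lift-pivot c))
                     (trans (Σ<-cong m (λ k _ → trans (cong (_* u (punchIn p k) i) (lift-punchIn c k))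
                                                      (ℚ.*-assoc α (c k) _)))
                            (Σ<-*ˡ m α (λ k → c k * u (punchIn p k) i))) ⟩
      (- S₀) * u p i + α * Sᵢ
        ≡⟨ solve 4 (λ s₀ upi a sᵢ → (:- s₀) :* upi :+ a :* sᵢ := a :* sᵢ :+ (:- upi) :* s₀) refl S₀ (u p i) α Sᵢ ⟩
      α * Sᵢ + (- u p i) * S₀
        ≡⟨ cong₂ _+_ (Σ<-*ˡ m α (λ k → c k * u (punchIn p k) i))
                     (Σ<-*ˡ m (- u p i) (λ k → c k * u (punchIn p k) 0)) ⟨
      Σ< m (λ k → α * (c k * u (punchIn p k) i)) + Σ< m (λ k → (- u p i) * (c k * u (punchIn p k) 0))
        ≡⟨ Σ<-+ m _ _ ⟨
      Σ< m (λ k → α * (c k * u (punchIn p k) i) + (- u p i) * (c k * u (punchIn p k) 0))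
        ≡⟨ Σ<-cong m (λ k _ → solve 5 (λ a x y z w → a :* (x :* y) :+ (:- w) :* (x :* z) := x :* (a :* y :+ (:- (z :* w))))
                                       refl α (c k) (u (punchIn p k) i) (u (punchIn p k) 0) (u p i)) ⟩
      Σ< m (λ k → c k * cleared k i) ∎
      where
      open ≡-Reasoning
      Sᵢ = Σ< m (λ k → c k * u (punchIn p k) i)
      S₀ = Σ< m (λ k → c k * u (punchIn p k) 0)

    cleared-pivot-coordinate : ∀ k → cleared k 0 ≡ 0ℚ
    cleared-pivot-coordinate k =
      solve 2 (λ a x → a :* x :+ (:- (x :* a)) := con 0ℚ) refl α (u (punchIn p k) 0)

  linear-dependence : ∀ d m → d < m → (u : ℕ → ℕ → ℚ) →
    Σ (ℕ → ℚ) λ c → NonzeroBelow m c × Vanishes d m u c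
  linear-dependence zero m 0<m u = unit , (0 , 0<m , λ ()) , λ i ()
    where
    unit : ℕ → ℚ
    unit zero    = 1ℚ
    unit (suc _) = 0ℚ
  linear-dependence (suc d) m d<m u with vanishing⊎nonzero m (λ j → u j 0)
  ... | inj₁ u₀≡0 =
    let c , c≢0 , vanishes = linear-dependence d m (ℕ.<-trans (ℕ.n<1+n d) d<m) (λ j i → u j (suc i))
    in c , c≢0 , λ { zero _ → Σ<-vanish m (λ j j<m → trans (cong (c j *_) (u₀≡0 j j<m)) (ℚ.*-zeroʳ (c j)))
                   ; (suc i) (s≤s i<d) → vanishes i i<d }
  linear-dependence (suc d) (suc m) d<m u | inj₂ (p , p≤m , α≢0) =
    lift c , lift-nonzero c c≢0 , vanishes′
    where
    open Pivot m u p p≤m α≢0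
    IH = linear-dependence d m (ℕ.≤-pred d<m) (λ k i → cleared k (suc i))
    c = proj₁ IH
    c≢0 = proj₁ (proj₂ IH)
    vanishes′ : Vanishes (suc d) (suc m) u (lift c)
    vanishes′ zero _ = trans (lift-combination c 0)
      (Σ<-vanish m (λ k _ → trans (cong (c k *_) (cleared-pivot-coordinate k)) (ℚ.*-zeroʳ (c k))))
    vanishes′ (suc i) (s≤s i<d) = trans (lift-combination c (suc i)) (proj₂ (proj₂ IH) i i<d)

  last-nonzero : ∀ m c → NonzeroBelow m c → Σ ℕ λ h → h < m × c h ≢ 0ℚ × (∀ j → h < j → j < m → c j ≡ 0ℚ)
  last-nonzero zero    c (j , () , _)
  last-nonzero (suc m) c (j , j<m+1 , cj≢0) with c m ℚ.≟ 0ℚ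
  ... | no  cm≢0 = m , ℕ.≤-refl , cm≢0 , λ j m<j j≤m → ⊥-elim (ℕ.<-irrefl refl (ℕ.≤-trans j≤m m<j))
  ... | yes cm≡0 with j ≟ m
  ...   | yes refl = ⊥-elim (cj≢0 cm≡0)
  ...   | no  j≢m  =
    let h , h<m , ch≢0 , above = last-nonzero m c (j , ℕ.≤∧≢⇒< (ℕ.≤-pred j<m+1) j≢m , cj≢0)
    in h , ℕ.m≤n⇒m≤1+n h<m , ch≢0 , λ j′ h<j′ j′≤m → above′ above j′ h<j′ j′≤m
    where
    above′ : ∀ {h} → (∀ j → h < j → j < m → c j ≡ 0ℚ) → ∀ j → h < j → j < suc m → c j ≡ 0ℚ
    above′ above j h<j j≤m with j ≟ m
    ... | yes refl = cm≡0
    ... | no  j≢m  = above j h<j (ℕ.≤∧≢⇒< (ℕ.≤-pred j≤m) j≢m)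

  coeff-applyUpTo-< : ∀ f m t → t < m → coeff (applyUpTo f m) t ≡ f t
  coeff-applyUpTo-< f (suc m) zero    _         = refl
  coeff-applyUpTo-< f (suc m) (suc t) (s≤s t<m) = coeff-applyUpTo-< (f ∘ suc) m t t<m

  coeff-applyUpTo-≥ : ∀ f m t → m ≤ t → coeff (applyUpTo f m) t ≡ 0ℚ
  coeff-applyUpTo-≥ f zero    t       _         = refl
  coeff-applyUpTo-≥ f (suc m) (suc t) (s≤s m≤t) = coeff-applyUpTo-≥ (f ∘ suc) m t m≤t

  rational-congˡ : ∀ {a b : ℕ → ℕ} → (∀ n → a n ≡ b n) → IsRationalSeries b → IsRationalSeries a
  rational-congˡ {a} {b} a≡b (P , Q , Q₀≢0 , QF≡P) = P , Q , Q₀≢0 , λ n → trans (lemma n) (QF≡P n)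
    where
    lemma : ∀ n → convCoeff Q a n ≡ convCoeff Q b n
    lemma n = trans (sumTo≡Σ< n _) (trans (Σ<-cong (suc n) (λ i _ → cong (λ z → coeff Q i * ℕtoℚ z) (a≡b (n ∸ i))))
                                          (sym (sumTo≡Σ< n _)))

  -- Components of a sequence of vectors in ℕ^d obeying a(n+1) = T a(n) have rational
  -- generating functions: a linear dependence Σ_{j≤h} c_j a(n+j) = 0 with c_h ≠ 0 holds at
  -- n = 0 (d+1 vectors in ℚ^d), hence at every n, and Q(x) = Σ_t c_{h-t} xᵗ makes Q·F a
  -- polynomial of degree < h.
  module LinearRecurrence (d : ℕ) (T : ℕ → ℕ → ℕ) (a : ℕ → ℕ → ℕ)
    (step : ∀ i n → i < d → a i (suc n) ≡ sum (applyUpTo (λ k → T i k *ℕ a k n) d)) where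

    v : ℕ → ℕ → ℚ
    v n i = ℕtoℚ (a i n)

    dependence = linear-dependence d (suc d) ℕ.≤-refl v
    c = proj₁ dependence
    top = last-nonzero (suc d) c (proj₁ (proj₂ dependence))
    h = proj₁ top
    h≤d = proj₁ (proj₂ top)
    ch≢0 = proj₁ (proj₂ (proj₂ top))
    c-above-h = proj₂ (proj₂ (proj₂ top))

    dependence-at-0 : ∀ i → i < d → Σ< (suc h) (λ j → c j * v j i) ≡ 0ℚ
    dependence-at-0 i i<d = trans
      (sym (Σ<-truncate (suc d) (suc h) _ h≤d
        (λ j h<j j≤d → trans (cong (_* v j i) (c-above-h j h<j j≤d)) (ℚ.*-zeroˡ (v j i)))))
      (proj₂ (proj₂ dependence) i i<d)

    step-ℚ : ∀ i n → i < d → v (suc n) i ≡ Σ< d (λ k → ℕtoℚ (T i k) * v n k)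
    step-ℚ i n i<d = trans (cong ℕtoℚ (step i n i<d))
      (trans (ℕtoℚ-sum d (λ k → T i k *ℕ a k n)) (Σ<-cong d (λ k _ → ℕtoℚ-* (T i k) (a k n))))

    dependence-at : ∀ n i → i < d → Σ< (suc h) (λ j → c j * v (n +ℕ j) i) ≡ 0ℚ
    dependence-at zero    i i<d = dependence-at-0 i i<d
    dependence-at (suc n) i i<d = begin
      Σ< (suc h) (λ j → c j * v (suc n +ℕ j) i)
        ≡⟨ Σ<-cong (suc h) (λ j _ → trans (cong (c j *_) (step-ℚ i (n +ℕ j) i<d))
             (trans (sym (Σ<-*ˡ d (c j) _))
               (Σ<-cong d (λ k _ → solve 3 (λ x y z → x :* (y :* z) := y :* (x :* z)) refl
                                            (c j) (ℕtoℚ (T i k)) (v (n +ℕ j) k))))) ⟩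
      Σ< (suc h) (λ j → Σ< d (λ k → ℕtoℚ (T i k) * (c j * v (n +ℕ j) k)))
        ≡⟨ Σ<-comm (suc h) d _ ⟩
      Σ< d (λ k → Σ< (suc h) (λ j → ℕtoℚ (T i k) * (c j * v (n +ℕ j) k)))
        ≡⟨ Σ<-vanish d (λ k k<d → trans (Σ<-*ˡ (suc h) (ℕtoℚ (T i k)) _)
             (trans (cong (ℕtoℚ (T i k) *_) (dependence-at n k k<d)) (ℚ.*-zeroʳ (ℕtoℚ (T i k))))) ⟩
      0ℚ ∎
      where open ≡-Reasoning

    module Component (i₀ : ℕ) (i₀<d : i₀ < d) where

      A : ℕ → ℕ
      A = a i₀

      Q : List ℚ
      Q = applyUpTo (λ t → c (h ∸ t)) (suc h)

      coeff-Q-≥ : ∀ t → suc h ≤ t → coeff Q t ≡ 0ℚ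
      coeff-Q-≥ = coeff-applyUpTo-≥ (λ t → c (h ∸ t)) (suc h)

      P : List ℚ
      P = applyUpTo (convCoeff Q A) h

      convCoeff-beyond : ∀ e → convCoeff Q A (h +ℕ e) ≡ 0ℚ
      convCoeff-beyond e = begin
        sumTo (h +ℕ e) g                        ≡⟨ sumTo≡Σ< (h +ℕ e) g ⟩
        Σ< (suc (h +ℕ e)) g                     ≡⟨ Σ<-truncate (suc (h +ℕ e)) (suc h) g (s≤s (ℕ.m≤m+n h e))
                                                     (λ j h<j _ → trans (cong (_* ℕtoℚ (A (h +ℕ e ∸ j))) (coeff-Q-≥ j h<j))
                                                                        (ℚ.*-zeroˡ (ℕtoℚ (A (h +ℕ e ∸ j))))) ⟩
        Σ< (suc h) g                            ≡⟨ Σ<-reverse (suc h) g ⟩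
        Σ< (suc h) (λ t → g (h ∸ t))            ≡⟨ Σ<-cong (suc h) (λ t t≤h → reindex t (ℕ.≤-pred t≤h)) ⟩
        Σ< (suc h) (λ t → c t * v (e +ℕ t) i₀)  ≡⟨ dependence-at e i₀ i₀<d ⟩
        0ℚ                                      ∎
        where
        open ≡-Reasoning
        g : ℕ → ℚ
        g t = coeff Q t * ℕtoℚ (A (h +ℕ e ∸ t))
        index : ∀ t → t ≤ h → h +ℕ e ∸ (h ∸ t) ≡ e +ℕ t
        index t t≤h = begin
          h +ℕ e ∸ (h ∸ t)    ≡⟨ cong (_∸ (h ∸ t)) (ℕ.+-comm h e) ⟩
          e +ℕ h ∸ (h ∸ t)    ≡⟨ ℕ.+-∸-assoc e (ℕ.m∸n≤m h t) ⟩
          e +ℕ (h ∸ (h ∸ t))  ≡⟨ cong (e +ℕ_) (ℕ.m∸[m∸n]≡n t≤h) ⟩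
          e +ℕ t              ∎
        reindex : ∀ t → t ≤ h → g (h ∸ t) ≡ c t * v (e +ℕ t) i₀
        reindex t t≤h = cong₂ _*_
          (trans (coeff-applyUpTo-< (λ t → c (h ∸ t)) (suc h) (h ∸ t) (s≤s (ℕ.m∸n≤m h t))) (cong c (ℕ.m∸[m∸n]≡n t≤h)))
          (cong (ℕtoℚ ∘ A) (index t t≤h))

      rational : IsRationalSeries A
      rational = P , Q , ch≢0 , QA≡P
        where
        QA≡P : ∀ n → convCoeff Q A n ≡ coeff P n
        QA≡P n with ℕ.≤-<-connex h n
        ... | inj₂ n<h = sym (coeff-applyUpTo-< (convCoeff Q A) h n n<h)
        ... | inj₁ h≤n = trans (subst (λ z → convCoeff Q A z ≡ 0ℚ) (ℕ.m+[n∸m]≡n h≤n) (convCoeff-beyond (n ∸ h)))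
                               (sym (coeff-applyUpTo-≥ (convCoeff Q A) h n h≤n))

  rational-of-linear-recurrence : (d : ℕ) (T : ℕ → ℕ → ℕ) (a : ℕ → ℕ → ℕ) →
    (∀ i n → i < d → a i (suc n) ≡ sum (applyUpTo (λ k → T i k *ℕ a k n) d)) →
    ∀ i → i < d → IsRationalSeries (a i)
  rational-of-linear-recurrence d T a step i i<d = LinearRecurrence.Component.rational d T a step i i<d

module Counting where

  open import Data.Nat using (ℕ; suc)
  open import Data.List using (List; []; _∷_; length)
  open import Data.List.Relation.Unary.All as All using ()
  open import Data.List.Relation.Unary.AllPairs using ([]; _∷_)
  open import Data.List.Relation.Unary.Any using (here; there)
  open import Data.List.Membership.Propositional using (_∈_)
  open import Data.List.Membership.Propositional.Properties.WithK using (unique∧set⇒bag)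
  open import Data.List.Relation.Unary.Unique.Propositional using (Unique)
  open import Data.List.Relation.Binary.BagAndSetEquality using (∼bag⇒↭)
  open import Data.List.Relation.Binary.Permutation.Propositional.Properties using (↭-length)
  open import Data.Product using (Σ; _×_; _,_; proj₁; proj₂)
  open import Data.Empty using (⊥)
  open import Function.Bundles using (mk⇔)
  open import Relation.Binary.PropositionalEquality using (_≡_; refl; sym; trans; cong)


  IsCount-unique : {A : Set} {P : A → Set} {m m′ : ℕ} → IsCount P m → IsCount P m′ → m ≡ m′
  IsCount-unique (L , uL , L⊆P , P⊆L , length≡) (L′ , uL′ , L′⊆P , P⊆L′ , length≡′) =
    trans (sym length≡) (trans (↭-length (∼bag⇒↭ (unique∧set⇒bag uL uL′
      (mk⇔ (λ x∈ → P⊆L′ _ (L⊆P _ x∈)) (λ x∈ → P⊆L _ (L′⊆P _ x∈)))))) length≡′)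

  module Transfer {A B : Set} {P : A → Set} {Q : B → Set} (R : A → B → Set)
    (image : ∀ x → P x → Σ B λ y → Q y × R x y)
    (functional : ∀ {x y y′} → P x → Q y → Q y′ → R x y → R x y′ → y ≡ y′)
    (injective : ∀ {x x′ y} → P x → P x′ → Q y → R x y → R x′ y → x ≡ x′)
    (surjective : ∀ y → Q y → Σ A λ x → P x × R x y) where

    images : (L : List A) → (∀ x → x ∈ L → P x) → List B
    images []      _   = []
    images (x ∷ L) L⊆P = proj₁ (image x (L⊆P x (here refl))) ∷ images L (λ z z∈ → L⊆P z (there z∈))

    length-images : ∀ L L⊆P → length (images L L⊆P) ≡ length L
    length-images []      _   = refl
    length-images (x ∷ L) L⊆P = cong suc (length-images L _)

    ∈-images⁻ : ∀ L L⊆P y → y ∈ images L L⊆P → Σ A λ x → x ∈ L × R x y × Q y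
    ∈-images⁻ (x ∷ L) L⊆P y (here refl) = x , here refl , proj₂ (proj₂ (image x _)) , proj₁ (proj₂ (image x _))
    ∈-images⁻ (x ∷ L) L⊆P y (there y∈) =
      let x′ , x′∈ , Rx′y , Qy = ∈-images⁻ L _ y y∈ in x′ , there x′∈ , Rx′y , Qy

    ∈-images⁺ : ∀ L L⊆P x y → x ∈ L → R x y → Q y → y ∈ images L L⊆P
    ∈-images⁺ (x ∷ L) L⊆P .x y (here refl) Rxy Qy =
      here (functional (L⊆P x (here refl)) Qy (proj₁ (proj₂ (image x _))) Rxy (proj₂ (proj₂ (image x _))))
    ∈-images⁺ (x ∷ L) L⊆P x′ y (there x′∈) Rx′y Qy = there (∈-images⁺ L _ x′ y x′∈ Rx′y Qy)

    images-unique : ∀ L L⊆P → Unique L → Unique (images L L⊆P)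
    images-unique []      _   []          = []
    images-unique (x ∷ L) L⊆P (x∉L ∷ uL) = All.tabulate distinct ∷ images-unique L _ uL
      where
      distinct : ∀ {y} → y ∈ images L _ → proj₁ (image x (L⊆P x (here refl))) ≡ y → ⊥
      distinct {y} y∈ refl with ∈-images⁻ L _ y y∈
      ... | x′ , x′∈ , Rx′y , Qy =
        All.lookup x∉L x′∈ (injective (L⊆P x (here refl)) (L⊆P x′ (there x′∈)) Qy (proj₂ (proj₂ (image x _))) Rx′y)

    IsCount-transfer : ∀ {m} → IsCount P m → IsCount Q m
    IsCount-transfer (L , uL , L⊆P , P⊆L , length≡) =
      images L L⊆P , images-unique L L⊆P uL ,
      (λ y y∈ → proj₂ (proj₂ (proj₂ (∈-images⁻ L L⊆P y y∈)))) ,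
      (λ y Qy → let x , Px , Rxy = surjective y Qy in ∈-images⁺ L L⊆P x y (P⊆L x Px) Rxy Qy) ,
      trans (length-images L L⊆P) length≡

module Chains where

  open import Data.Nat using (ℕ; zero; suc; _<_; _>_; _≤_; z≤n; s≤s; _<?_; _+_; _*_)
  import Data.Nat.Properties as ℕ
  open import Data.List using (List; []; _∷_; length; filter; map)
  import Data.List.Properties as List
  open import Data.List.Relation.Unary.All as All using (All; []; _∷_)
  open import Data.List.Relation.Unary.All.Properties using (all-filter; filter⁺)
  open import Data.List.Relation.Unary.AllPairs using (AllPairs; []; _∷_)
  open import Data.List.Relation.Unary.Any using (here; there)
  open import Data.List.Membership.Propositional using (_∈_)
  open import Data.List.Relation.Unary.Unique.Propositional using (Unique)
  import Data.List.Relation.Unary.Unique.Propositional.Properties as Unique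
  open import Data.List.Relation.Binary.Sublist.Propositional using (_⊆_; []; _∷_; _∷ʳ_; minimum)
  open import Data.List.Relation.Binary.Sublist.Propositional.Properties using (filter-⊆)
  open import Data.Maybe using (Maybe; just; nothing)
  import Data.Maybe as Maybe
  open import Data.Maybe.Relation.Unary.All using (just; nothing) renaming (All to AllMaybe)
  open import Data.Product using (Σ; _×_; _,_)
  open import Data.Unit using (⊤; tt)
  open import Data.Empty using (⊥-elim)
  open import Relation.Binary.PropositionalEquality using (_≡_; _≢_; refl; sym; trans; cong; subst)
  open import Relation.Nullary using (¬_; Dec; yes; no)
  open import Relation.Nullary.Decidable using (¬?; _×-dec_)
  open import Relation.Unary using (Decidable)
  open import Relation.Binary.Definitions using (DecidableEquality)
  open import Function using (_∘_)

  Follows : {A : Set} → (A → A → Set) → Maybe A → A → Set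
  Follows R nothing  _ = ⊤
  Follows R (just y) x = R y x

  data Chain {A : Set} (R : A → A → Set) : Maybe A → ℕ → List A → Set where
    done : ∀ {p xs} → Chain R p 0 xs
    take : ∀ {p m x xs} → Follows R p x → Chain R (just x) m xs → Chain R p (suc m) (x ∷ xs)
    skip : ∀ {p m x xs} → Chain R p (suc m) xs → Chain R p (suc m) (x ∷ xs)

  module _ {A : Set} {R : A → A → Set} where

    follows? : (∀ x y → Dec (R x y)) → ∀ p x → Dec (Follows R p x)
    follows? R? nothing  x = yes tt
    follows? R? (just y) x = R? y x

    chain? : (∀ x y → Dec (R x y)) → ∀ p m xs → Dec (Chain R p m xs)
    chain? R? p zero    xs       = yes done
    chain? R? p (suc m) []       = no λ ()
    chain? R? p (suc m) (x ∷ xs) with follows? R? p x | chain? R? (just x) m xs | chain? R? p (suc m) xs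
    ... | yes px  | yes c  | _      = yes (take px c)
    ... | _       | _      | yes c  = yes (skip c)
    ... | no ¬px  | _      | no ¬c  = no λ { (take px _) → ¬px px ; (skip c) → ¬c c }
    ... | yes _   | no ¬c′ | no ¬c  = no λ { (take _ c′) → ¬c′ c′ ; (skip c) → ¬c c }

    Chain-⊆ : ∀ {p m xs ys} → xs ⊆ ys → Chain R p m xs → Chain R p m ys
    Chain-⊆ _             done       = done
    Chain-⊆ (refl ∷ xs⊆)  (take r c) = take r (Chain-⊆ xs⊆ c)
    Chain-⊆ (refl ∷ xs⊆)  (skip c)   = skip (Chain-⊆ xs⊆ c)
    Chain-⊆ (y ∷ʳ xs⊆)    c@(take _ _) = skip (Chain-⊆ xs⊆ c)
    Chain-⊆ (y ∷ʳ xs⊆)    c@(skip _)   = skip (Chain-⊆ xs⊆ c)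

    Chain-filter : ∀ {P : A → Set} (P? : Decidable P) {p m} xs → Chain R p m (filter P? xs) → Chain R p m xs
    Chain-filter P? xs = Chain-⊆ (filter-⊆ P? xs)

    Chain-raise : ∀ {x m xs} → All (R x) xs → Chain R nothing m xs → Chain R (just x) m xs
    Chain-raise _          done       = done
    Chain-raise (rx ∷ _)   (take _ c) = take rx c
    Chain-raise (_ ∷ rxs)  (skip c)   = skip (Chain-raise rxs c)

    AllPairs⇒Chain : ∀ xs → AllPairs R xs → Chain R nothing (length xs) xs
    AllPairs⇒Chain []       []          = done
    AllPairs⇒Chain (x ∷ xs) (Rx ∷ Rxs) = take tt (Chain-raise Rx (AllPairs⇒Chain xs Rxs))

    Chain⇒AllPairs : (∀ {x y z} → R x y → R y z → R x z) → ∀ {p m xs} → Chain R p m xs →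
      Σ (List A) λ ys → ys ⊆ xs × length ys ≡ m × AllPairs R ys × All (Follows R p) ys
    Chain⇒AllPairs trans {xs = xs} done = [] , minimum xs , refl , [] , []
    Chain⇒AllPairs trans {p} (take {x = x} px c) with Chain⇒AllPairs trans c
    ... | ys , ys⊆ , length≡ , Rys , xRys = x ∷ ys , refl ∷ ys⊆ , cong suc length≡ , xRys ∷ Rys , px ∷ All.map (follows p px) xRys
      where
      follows : ∀ p {y} → Follows R p x → R x y → Follows R p y
      follows nothing  _   _   = tt
      follows (just z) zRx xRy = trans zRx xRy
    Chain⇒AllPairs trans {xs = x ∷ xs} (skip c) with Chain⇒AllPairs trans c
    ... | ys , ys⊆ , length≡ , Rys , pRys = ys , x ∷ʳ ys⊆ , length≡ , Rys , pRys

    Chain-mono : {S : A → A → Set} (P : A → Set) → (∀ {x y} → P x → P y → R x y → S x y) →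
      ∀ {p m xs} → AllMaybe P p → All P xs → Chain R p m xs → Chain S p m xs
    Chain-mono P R⇒S _        _          done                  = done
    Chain-mono P R⇒S nothing (px ∷ pxs) (take _ c)       = take tt (Chain-mono P R⇒S (just px) pxs c)
    Chain-mono P R⇒S (just py) (px ∷ pxs) (take r c)     = take (R⇒S py px r) (Chain-mono P R⇒S (just px) pxs c)
    Chain-mono P R⇒S pp       (_ ∷ pxs)  (skip c)              = skip (Chain-mono P R⇒S pp pxs c)

    Chain-map⁻ : {B : Set} {S : B → B → Set} (h : A → B) → (∀ {x y} → S (h x) (h y) → R x y) →
      ∀ {p m} xs → Chain S (Maybe.map h p) m (map h xs) → Chain R p m xs
    Chain-map⁻ h S⇒R {p} {zero}   xs       c          = done
    Chain-map⁻ h S⇒R {nothing} {suc m} (x ∷ xs) (take r c) = take tt (Chain-map⁻ h S⇒R xs c)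
    Chain-map⁻ h S⇒R {just y}  {suc m} (x ∷ xs) (take r c) = take (S⇒R r) (Chain-map⁻ h S⇒R xs c)
    Chain-map⁻ h S⇒R {p}       {suc m} (x ∷ xs) (skip c)   = skip (Chain-map⁻ h S⇒R xs c)

    Chain-map⁺ : {B : Set} {S : B → B → Set} (h : A → B) → (∀ {x y} → R x y → S (h x) (h y)) →
      ∀ {p m} xs → Chain R p m xs → Chain S (Maybe.map h p) m (map h xs)
    Chain-map⁺ h R⇒S         xs       done                 = done
    Chain-map⁺ h R⇒S {nothing} (x ∷ xs) (take r c)         = take tt (Chain-map⁺ h R⇒S xs c)
    Chain-map⁺ h R⇒S {just y}  (x ∷ xs) (take r c)         = take (R⇒S r) (Chain-map⁺ h R⇒S xs c)
    Chain-map⁺ h R⇒S         (x ∷ xs) (skip c)             = skip (Chain-map⁺ h R⇒S xs c)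

  All-filter : {A : Set} {P Q : A → Set} (P? : Decidable P) {xs : List A} → All Q xs → All (λ y → Q y × P y) (filter P? xs)
  All-filter P? {xs} qxs = All.zip (filter⁺ P? qxs , all-filter P? xs)

  length-filter-split : {A : Set} {P : A → Set} (P? : Decidable P) (xs : List A) →
    length xs ≡ length (filter P? xs) + length (filter (¬? ∘ P?) xs)
  length-filter-split P? []       = refl
  length-filter-split P? (x ∷ xs) with P? x
  ... | yes _ = cong suc (length-filter-split P? xs)
  ... | no  _ = trans (cong suc (length-filter-split P? xs)) (sym (ℕ.+-suc _ _))

  length-split-at : ∀ x xs → All (x ≢_) xs → length xs ≡ length (filter (x <?_) xs) + length (filter (_<? x) xs)
  length-split-at x []       []             = refl
  length-split-at x (y ∷ ys) (x≢y ∷ x≢ys) with x <? y | y <? x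
  ... | yes x<y | yes y<x = ⊥-elim (ℕ.<-asym x<y y<x)
  ... | yes x<y | no  y≮x rewrite List.filter-accept (x <?_) {xs = ys} x<y | List.filter-reject (_<? x) {xs = ys} y≮x =
    cong suc (length-split-at x ys x≢ys)
  ... | no  x≮y | yes y<x rewrite List.filter-reject (x <?_) {xs = ys} x≮y | List.filter-accept (_<? x) {xs = ys} y<x =
    trans (cong suc (length-split-at x ys x≢ys)) (sym (ℕ.+-suc _ _))
  ... | no  x≮y | no  y≮x = ⊥-elim (x≢y (ℕ.≤-antisym (ℕ.≮⇒≥ y≮x) (ℕ.≮⇒≥ x≮y)))

  esBound : ℕ → ℕ → ℕ
  esBound zero    _       = 0
  esBound (suc J) zero    = 0
  esBound (suc J) (suc K) = suc (esBound J (suc K) + esBound (suc J) K)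

  erdős-szekeres : ∀ J K xs → Unique xs → ¬ Chain _<_ nothing J xs → ¬ Chain _>_ nothing K xs → length xs ≤ esBound J K
  erdős-szekeres zero    K       xs       _           ¬inc ¬dec = ⊥-elim (¬inc done)
  erdős-szekeres (suc J) zero    xs       _           ¬inc ¬dec = ⊥-elim (¬dec done)
  erdős-szekeres (suc J) (suc K) []       _           ¬inc ¬dec = z≤n
  erdős-szekeres (suc J) (suc K) (x ∷ xs) (x∉xs ∷ u) ¬inc ¬dec =
    subst (_≤ esBound (suc J) (suc K)) (cong suc (sym (length-split-at x xs x∉xs)))
      (s≤s (ℕ.+-mono-≤ (erdős-szekeres J (suc K) above (Unique.filter⁺ (x <?_) u) ¬inc-above ¬dec-above)
                       (erdős-szekeres (suc J) K below (Unique.filter⁺ (_<? x) u) ¬inc-below ¬dec-below)))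
    where
    above = filter (x <?_) xs
    below = filter (_<? x) xs
    ¬inc-above : ¬ Chain _<_ nothing J above
    ¬inc-above c = ¬inc (take tt (Chain-filter (x <?_) xs (Chain-raise (all-filter (x <?_) xs) c)))
    ¬dec-above : ¬ Chain _>_ nothing (suc K) above
    ¬dec-above c = ¬dec (skip (Chain-filter (x <?_) xs c))
    ¬inc-below : ¬ Chain _<_ nothing (suc J) below
    ¬inc-below c = ¬inc (skip (Chain-filter (_<? x) xs c))
    ¬dec-below : ¬ Chain _>_ nothing K below
    ¬dec-below c = ¬dec (take tt (Chain-filter (_<? x) xs (Chain-raise (all-filter (_<? x) xs) c)))

  Monochromatic : {A C : Set} → (A → C) → (A → A → Set) → A → A → Set
  Monochromatic colour R x y = colour x ≡ colour y × R x y

  monochromatic? : {A C : Set} → DecidableEquality C → (colour : A → C) → {R : A → A → Set} →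
    (∀ x y → Dec (R x y)) → ∀ x y → Dec (Monochromatic colour R x y)
  monochromatic? _≟_ colour R? x y = (colour x ≟ colour y) ×-dec R? x y

  colored-erdős-szekeres : {C : Set} → DecidableEquality C → (colour : ℕ → C) (cs : List C) →
    ∀ J K xs → Unique xs → All (λ x → colour x ∈ cs) xs →
    ¬ Chain (Monochromatic colour _<_) nothing J xs → ¬ Chain (Monochromatic colour _>_) nothing K xs →
    length xs ≤ length cs * esBound J K
  colored-erdős-szekeres _≟_ colour []       J K []       _ _               _ _ = z≤n
  colored-erdős-szekeres _≟_ colour []       J K (x ∷ xs) _ (() ∷ _)        _ _
  colored-erdős-szekeres _≟_ colour (c ∷ cs) J K xs       u xs∈cs ¬inc ¬dec =
    subst (_≤ esBound J K + length cs * esBound J K) (sym (length-filter-split has-c? xs))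
      (ℕ.+-mono-≤ (erdős-szekeres J K coloured (Unique.filter⁺ has-c? u) (¬inc ∘ mono) (¬dec ∘ mono))
                  (colored-erdős-szekeres _≟_ colour cs J K others (Unique.filter⁺ (¬? ∘ has-c?) u) others∈cs
                    (¬inc ∘ Chain-filter (¬? ∘ has-c?) xs) (¬dec ∘ Chain-filter (¬? ∘ has-c?) xs)))
    where
    has-c? = λ x → colour x ≟ c
    coloured = filter has-c? xs
    others = filter (¬? ∘ has-c?) xs
    mono : ∀ {R m} → Chain R nothing m coloured → Chain (Monochromatic colour R) nothing m xs
    mono ch = Chain-filter has-c? xs
      (Chain-mono (λ x → colour x ≡ c) (λ cx cy r → trans cx (sym cy) , r) nothing (all-filter has-c? xs) ch)
    others∈cs : All (λ x → colour x ∈ cs) others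
    others∈cs = All.map (λ { (here eq , ≢c) → ⊥-elim (≢c eq) ; (there x∈ , _) → x∈ }) (All-filter (¬? ∘ has-c?) xs∈cs)

module ListOps where

  open import Data.Nat using (ℕ; zero; suc; _<_; _≤_; z≤n; s≤s; _<?_; _≟_; _+_; _*_; _∸_)
  import Data.Nat.Properties as ℕ
  open import Data.List using (List; []; _∷_; [_]; length; map; filter; _++_; applyUpTo; concatMap)
  open import Data.Nat.ListAction using (sum)
  import Data.List.Properties as List
  open import Data.List.Relation.Unary.All as All using (All; []; _∷_)
  open import Data.List.Relation.Unary.AllPairs using (AllPairs; []; _∷_)
  import Data.List.Relation.Unary.AllPairs.Properties as AllPairs
  open import Data.List.Relation.Unary.Any as Any using (here; there)
  open import Data.List.Membership.Propositional using (_∈_; _∉_; find; lose)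
  open import Data.List.Membership.Propositional.Properties using (∈-applyUpTo⁺; ∈-applyUpTo⁻; ∈-map⁺; ∈-map⁻; ∈-concatMap⁺; ∈-concatMap⁻)
  open import Data.List.Relation.Unary.Unique.Propositional using (Unique)
  open import Data.List.Relation.Binary.Sublist.Propositional using (_⊆_; []; _∷_; _∷ʳ_)
  open import Data.List.Relation.Binary.Sublist.Propositional.Properties using (Any-resp-⊆)
  import Data.List.Relation.Unary.Unique.Propositional.Properties as Unique
  open import Data.Maybe using (Maybe; just; nothing)
  import Data.Maybe as Maybe
  open import Data.Product using (Σ; _×_; _,_; proj₁; proj₂)
  open import Data.Sum using (_⊎_; inj₁; inj₂)
  open import Data.Empty using (⊥-elim)
  open import Relation.Binary.PropositionalEquality using (_≡_; _≢_; refl; sym; trans; cong; cong₂; subst)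
  open import Function using (_∘_)
  open import Relation.Nullary using (¬_; yes; no)
  open import Relation.Nullary.Decidable using (dec-yes; dec-no)
  open import Relation.Unary using (Decidable)

  update : {A : Set} → (ℕ → A) → ℕ → A → ℕ → A
  update f n v x with x ≟ n
  ... | yes _ = v
  ... | no  _ = f x

  update-same : {A : Set} (f : ℕ → A) → ∀ n v → update f n v n ≡ v
  update-same f n v with n ≟ n
  ... | yes _   = refl
  ... | no  n≢n = ⊥-elim (n≢n refl)

  update-other : {A : Set} (f : ℕ → A) → ∀ n v x → x ≢ n → update f n v x ≡ f x
  update-other f n v x x≢n with x ≟ n
  ... | yes x≡n = ⊥-elim (x≢n x≡n)
  ... | no  _   = refl

  update-cong : {A : Set} {f f′ : ℕ → A} → (∀ x → f x ≡ f′ x) → ∀ n v x → update f n v x ≡ update f′ n v x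
  update-cong f≡f′ n v x with x ≟ n
  ... | yes _ = refl
  ... | no  _ = f≡f′ x

  by-cases : (P : ℕ → Set) (x n : ℕ) → (x ≡ n → P x) → (x ≢ n → P x) → P x
  by-cases P x n eq neq with x ≟ n
  ... | yes x≡n = eq x≡n
  ... | no  x≢n = neq x≢n

  insert : {A : Set} → ℕ → A → List A → List A
  insert zero    x ys       = x ∷ ys
  insert (suc p) x []       = [ x ]
  insert (suc p) x (y ∷ ys) = y ∷ insert p x ys

  module _ {A : Set} where

    ∈-insert⁻ : ∀ p (x : A) ys {y} → y ∈ insert p x ys → y ≡ x ⊎ y ∈ ys
    ∈-insert⁻ zero    x ys       (here eq)  = inj₁ eq
    ∈-insert⁻ zero    x ys       (there y∈) = inj₂ y∈
    ∈-insert⁻ (suc p) x []       (here eq)  = inj₁ eq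
    ∈-insert⁻ (suc p) x (z ∷ ys) (here eq)  = inj₂ (here eq)
    ∈-insert⁻ (suc p) x (z ∷ ys) (there y∈) with ∈-insert⁻ p x ys y∈
    ... | inj₁ eq  = inj₁ eq
    ... | inj₂ y∈′ = inj₂ (there y∈′)

    ∈-insert⁺ʳ : ∀ p (x : A) ys {y} → y ∈ ys → y ∈ insert p x ys
    ∈-insert⁺ʳ zero    x ys       y∈         = there y∈
    ∈-insert⁺ʳ (suc p) x (z ∷ ys) (here eq)  = here eq
    ∈-insert⁺ʳ (suc p) x (z ∷ ys) (there y∈) = there (∈-insert⁺ʳ p x ys y∈)

    ∈-insert⁺ˡ : ∀ p (x : A) ys → x ∈ insert p x ys
    ∈-insert⁺ˡ zero    x ys       = here refl
    ∈-insert⁺ˡ (suc p) x []       = here refl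
    ∈-insert⁺ˡ (suc p) x (y ∷ ys) = there (∈-insert⁺ˡ p x ys)

    insert-unique : ∀ p (x : A) ys → x ∉ ys → Unique ys → Unique (insert p x ys)
    insert-unique zero    x ys       x∉ u = All.tabulate (λ y∈ x≡y → x∉ (subst (_∈ ys) (sym x≡y) y∈)) ∷ u
    insert-unique (suc p) x []       x∉ u = [] ∷ []
    insert-unique (suc p) x (y ∷ ys) x∉ (y∉ ∷ u) =
      All.tabulate (λ {z} z∈ y≡z → distinct z z∈ y≡z) ∷ insert-unique p x ys (λ x∈ → x∉ (there x∈)) u
      where
      distinct : ∀ z → z ∈ insert p x ys → y ≢ z
      distinct z z∈ y≡z with ∈-insert⁻ p x ys z∈
      ... | inj₁ z≡x  = x∉ (here (trans (sym z≡x) (sym y≡z)))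
      ... | inj₂ z∈ys = All.lookup y∉ z∈ys y≡z

  map-insert : {A B : Set} (f : A → B) → ∀ p x ys → map f (insert p x ys) ≡ insert p (f x) (map f ys)
  map-insert f zero    x ys       = refl
  map-insert f (suc p) x []       = refl
  map-insert f (suc p) x (y ∷ ys) = cong (f y ∷_) (map-insert f p x ys)

  filter-insert-reject : ∀ {A : Set} {P : A → Set} (P? : Decidable P) p x ys → ¬ P x →
    filter P? (insert p x ys) ≡ filter P? ys
  filter-insert-reject P? zero    x ys       ¬Px = List.filter-reject P? ¬Px
  filter-insert-reject P? (suc p) x []       ¬Px = List.filter-reject P? ¬Px
  filter-insert-reject P? (suc p) x (y ∷ ys) ¬Px with P? y
  ... | yes _ = cong (y ∷_) (filter-insert-reject P? p x ys ¬Px)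
  ... | no  _ = filter-insert-reject P? p x ys ¬Px

  position : ℕ → List ℕ → Maybe ℕ
  position x []       = nothing
  position x (y ∷ ys) with x ≟ y
  ... | yes _ = just 0
  ... | no  _ = Maybe.map suc (position x ys)

  remove : ℕ → List ℕ → List ℕ
  remove x []       = []
  remove x (y ∷ ys) with x ≟ y
  ... | yes _ = ys
  ... | no  _ = y ∷ remove x ys

  position-insert : ∀ x p ys → x ∉ ys → p ≤ length ys → position x (insert p x ys) ≡ just p
  position-insert x zero    ys       x∉ _ rewrite dec-yes (x ≟ x) refl .proj₂ = refl
  position-insert x (suc p) (y ∷ ys) x∉ (s≤s p≤) rewrite dec-no (x ≟ y) (λ x≡y → x∉ (here x≡y))
    | position-insert x p ys (λ x∈ → x∉ (there x∈)) p≤ = refl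

  remove-insert : ∀ x p ys → x ∉ ys → remove x (insert p x ys) ≡ ys
  remove-insert x zero    ys       x∉ rewrite dec-yes (x ≟ x) refl .proj₂ = refl
  remove-insert x (suc p) []       x∉ rewrite dec-yes (x ≟ x) refl .proj₂ = refl
  remove-insert x (suc p) (y ∷ ys) x∉ rewrite dec-no (x ≟ y) (λ x≡y → x∉ (here x≡y)) =
    cong (y ∷_) (remove-insert x p ys (λ x∈ → x∉ (there x∈)))

  position-∉ : ∀ x ys → x ∉ ys → position x ys ≡ nothing
  position-∉ x []       x∉ = refl
  position-∉ x (y ∷ ys) x∉ rewrite dec-no (x ≟ y) (λ x≡y → x∉ (here x≡y)) | position-∉ x ys (λ x∈ → x∉ (there x∈)) = refl

  position-nothing : ∀ x ys → position x ys ≡ nothing → x ∉ ys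
  position-nothing x (y ∷ ys) eq x∈ with x ≟ y
  position-nothing x (y ∷ ys) ()  x∈          | yes _
  position-nothing x (y ∷ ys) eq  (here x≡y)  | no x≢y = x≢y x≡y
  position-nothing x (y ∷ ys) eq  (there x∈)  | no x≢y with position x ys | position-nothing x ys
  ... | nothing | ih = ih refl x∈

  position-just : ∀ x ys p → position x ys ≡ just p → x ∈ ys × p < length ys × insert p x (remove x ys) ≡ ys
  position-just x (y ∷ ys) p eq with x ≟ y
  position-just x (y ∷ ys) .0 refl | yes refl = here refl , s≤s z≤n , refl
  position-just x (y ∷ ys) p  eq   | no x≢y with position x ys | position-just x ys
  position-just x (y ∷ ys) .(suc p′) refl | no x≢y | just p′ | ih =
    let x∈ , p′< , eq′ = ih p′ refl in there x∈ , s≤s p′< , cong (y ∷_) eq′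

  length-remove : ∀ x ys → x ∈ ys → length ys ≡ suc (length (remove x ys))
  length-remove x (y ∷ ys) x∈ with x ≟ y
  ... | yes _ = refl
  ... | no x≢y with x∈
  ...   | here x≡y  = ⊥-elim (x≢y x≡y)
  ...   | there x∈′ = cong suc (length-remove x ys x∈′)

  ∈-remove⁻ : ∀ x ys {y} → y ∈ remove x ys → y ∈ ys
  ∈-remove⁻ x (z ∷ ys) y∈ with x ≟ z
  ... | yes _ = there y∈
  ... | no  _ with y∈
  ...   | here eq   = here eq
  ...   | there y∈′ = there (∈-remove⁻ x ys y∈′)

  ∈-remove⁺ : ∀ x ys {y} → y ∈ ys → y ≢ x → y ∈ remove x ys
  ∈-remove⁺ x (z ∷ ys) (here refl) y≢x with x ≟ z
  ... | yes x≡z = ⊥-elim (y≢x (sym x≡z))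
  ... | no  _   = here refl
  ∈-remove⁺ x (z ∷ ys) (there y∈) y≢x with x ≟ z
  ... | yes _ = y∈
  ... | no  _ = there (∈-remove⁺ x ys y∈ y≢x)

  remove-unique : ∀ x ys → Unique ys → Unique (remove x ys) × x ∉ remove x ys
  remove-unique x []       u          = [] , λ ()
  remove-unique x (y ∷ ys) (y∉ ∷ u) with x ≟ y
  ... | yes refl = u , λ x∈ → All.lookup y∉ x∈ refl
  ... | no  x≢y  = let u′ , x∉ = remove-unique x ys u in
    All.tabulate (λ z∈ → All.lookup y∉ (∈-remove⁻ x ys z∈)) ∷ u′ ,
    λ { (here x≡y) → x≢y x≡y ; (there x∈) → x∉ x∈ }

  rank : ℕ → List ℕ → ℕ
  rank x q = length (filter (_<? x) q)

  rank-below : ∀ x z zs → z < x → rank x (z ∷ zs) ≡ suc (rank x zs)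
  rank-below x z zs z<x = cong length (List.filter-accept (_<? x) {xs = zs} z<x)

  rank-above : ∀ x z zs → ¬ z < x → rank x (z ∷ zs) ≡ rank x zs
  rank-above x z zs z≮x = cong length (List.filter-reject (_<? x) {xs = zs} z≮x)

  rank-mono : ∀ x y q → x ≤ y → rank x q ≤ rank y q
  rank-mono x y []       x≤y = z≤n
  rank-mono x y (z ∷ zs) x≤y with z <? x | z <? y
  ... | yes z<x | yes z<y rewrite rank-below x z zs z<x | rank-below y z zs z<y = s≤s (rank-mono x y zs x≤y)
  ... | yes z<x | no  z≮y = ⊥-elim (z≮y (ℕ.<-≤-trans z<x x≤y))
  ... | no  z≮x | yes z<y rewrite rank-above x z zs z≮x | rank-below y z zs z<y = ℕ.m≤n⇒m≤1+n (rank-mono x y zs x≤y)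
  ... | no  z≮x | no  z≮y rewrite rank-above x z zs z≮x | rank-above y z zs z≮y = rank-mono x y zs x≤y

  rank-strict : ∀ x y q → x ∈ q → x < y → rank x q < rank y q
  rank-strict x y (z ∷ zs) (here refl) x<y rewrite rank-above x x zs (ℕ.<-irrefl refl) | rank-below y x zs x<y =
    s≤s (rank-mono x y zs (ℕ.<⇒≤ x<y))
  rank-strict x y (z ∷ zs) (there x∈) x<y with z <? x | z <? y
  ... | yes z<x | yes z<y rewrite rank-below x z zs z<x | rank-below y z zs z<y = s≤s (rank-strict x y zs x∈ x<y)
  ... | yes z<x | no  z≮y = ⊥-elim (z≮y (ℕ.<-trans z<x x<y))
  ... | no  z≮x | yes z<y rewrite rank-above x z zs z≮x | rank-below y z zs z<y = ℕ.m≤n⇒m≤1+n (rank-strict x y zs x∈ x<y)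
  ... | no  z≮x | no  z≮y rewrite rank-above x z zs z≮x | rank-above y z zs z≮y = rank-strict x y zs x∈ x<y

  rank-<⇒< : ∀ x y q → rank x q < rank y q → x < y
  rank-<⇒< x y q rx<ry with x <? y
  ... | yes x<y = x<y
  ... | no  x≮y = ⊥-elim (ℕ.<⇒≱ rx<ry (rank-mono y x q (ℕ.≮⇒≥ x≮y)))

  rank-< : ∀ x q → x ∈ q → rank x q < length q
  rank-< x q x∈ = List.filter-notAll (_<? x) q (Any.map (λ { refl → ℕ.<-irrefl refl }) x∈)

  interval : ℕ → ℕ → List ℕ
  interval t = applyUpTo (t +_)

  ∈-interval⁻ : ∀ t k {y} → y ∈ interval t k → t ≤ y × y < t + k
  ∈-interval⁻ t k y∈ with ∈-applyUpTo⁻ (t +_) y∈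
  ... | i , i<k , refl = ℕ.m≤m+n t i , ℕ.+-monoʳ-< t i<k

  ∈-interval⁺ : ∀ t k {y} → t ≤ y → y < t + k → y ∈ interval t k
  ∈-interval⁺ t k {y} t≤y y<t+k = subst (_∈ interval t k) (ℕ.m+[n∸m]≡n t≤y)
    (∈-applyUpTo⁺ (t +_) (ℕ.+-cancelˡ-< t _ _ (subst (_< t + k) (sym (ℕ.m+[n∸m]≡n t≤y)) y<t+k)))

  interval-increasing : ∀ t k → AllPairs _<_ (interval t k)
  interval-increasing t k = AllPairs.applyUpTo⁺₁ (t +_) k (λ i<j _ → ℕ.+-monoʳ-< t i<j)

  interval-extend : ∀ n t → t ≤ n → interval t (suc n ∸ t) ≡ interval t (n ∸ t) ++ [ n ]
  interval-extend n t t≤n rewrite ℕ.+-∸-assoc 1 t≤n =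
    trans (sym (List.applyUpTo-∷ʳ (t +_) (n ∸ t))) (cong (λ z → interval t (n ∸ t) ++ [ z ]) (ℕ.m+[n∸m]≡n t≤n))

  map-filter-cong : {A B : Set} {P P′ : A → Set} (P? : Decidable P) (P′? : Decidable P′) (f f′ : A → B) (xs : List A) →
    (∀ y → y ∈ xs → (P y → P′ y) × (P′ y → P y)) → (∀ y → y ∈ xs → P y → f y ≡ f′ y) →
    map f (filter P? xs) ≡ map f′ (filter P′? xs)
  map-filter-cong P? P′? f f′ []       P⇔P′ f≡f′ = refl
  map-filter-cong P? P′? f f′ (x ∷ xs) P⇔P′ f≡f′ with P? x | P′? x
  ... | yes px | yes _   = cong₂ _∷_ (f≡f′ x (here refl) px) (map-filter-cong P? P′? f f′ xs (λ y → P⇔P′ y ∘ there) (λ y → f≡f′ y ∘ there))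
  ... | yes px | no ¬p′x = ⊥-elim (¬p′x (proj₁ (P⇔P′ x (here refl)) px))
  ... | no ¬px | yes p′x = ⊥-elim (¬px (proj₂ (P⇔P′ x (here refl)) p′x))
  ... | no _   | no _    = map-filter-cong P? P′? f f′ xs (λ y → P⇔P′ y ∘ there) (λ y → f≡f′ y ∘ there)

  module _ {A B : Set} (F : B → List A) where

    concatMap-unique : ∀ bs → Unique bs → (∀ b → b ∈ bs → Unique (F b)) →
      (∀ b b′ x → b ∈ bs → b′ ∈ bs → x ∈ F b → x ∈ F b′ → b ≡ b′) → Unique (concatMap F bs)
    concatMap-unique []       _          _        _        = []
    concatMap-unique (b ∷ bs) (b∉ ∷ u) unique-F disjoint =
      Unique.++⁺ (unique-F b (here refl))
        (concatMap-unique bs u (λ b′ → unique-F b′ ∘ there) (λ b₁ b₂ x b₁∈ b₂∈ → disjoint b₁ b₂ x (there b₁∈) (there b₂∈)))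
        (λ (x∈Fb , x∈rest) → let b′ , b′∈ , x∈Fb′ = find (∈-concatMap⁻ F {xs = bs} x∈rest) in
                             All.lookup b∉ b′∈ (disjoint b b′ _ (here refl) (there b′∈) x∈Fb x∈Fb′))

    length-concatMap : ∀ bs → length (concatMap F bs) ≡ sum (map (length ∘ F) bs)
    length-concatMap []       = refl
    length-concatMap (b ∷ bs) = trans (List.length-++ (F b)) (cong (length (F b) +_) (length-concatMap bs))

  prefixAll : {A : Set} → List A → List (List A) → List (List A)
  prefixAll xs ys = concatMap (λ x → map (x ∷_) ys) xs

  module _ {A : Set} where

    ∈-prefixAll⁺ : ∀ {x y} (xs : List A) (ys : List (List A)) → x ∈ xs → y ∈ ys → x ∷ y ∈ prefixAll xs ys
    ∈-prefixAll⁺ xs ys x∈ y∈ = ∈-concatMap⁺ (λ x → map (x ∷_) ys) (lose x∈ (∈-map⁺ (_ ∷_) y∈))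

    ∈-prefixAll⁻ : ∀ {z} (xs : List A) (ys : List (List A)) → z ∈ prefixAll xs ys → Σ A λ x → Σ (List A) λ y → x ∈ xs × y ∈ ys × z ≡ x ∷ y
    ∈-prefixAll⁻ xs ys z∈ with find (∈-concatMap⁻ (λ x → map (x ∷_) ys) {xs = xs} z∈)
    ... | x , x∈ , z∈′ with ∈-map⁻ (x ∷_) z∈′
    ...   | y , y∈ , refl = x , y , x∈ , y∈ , refl

    prefixAll-unique : (xs : List A) (ys : List (List A)) → Unique xs → Unique ys → Unique (prefixAll xs ys)
    prefixAll-unique xs ys uxs uys = concatMap-unique (λ x → map (x ∷_) ys) xs uxs
      (λ x _ → Unique.map⁺ (λ { refl → refl }) uys)
      (λ x x′ z _ _ z∈ z∈′ → let _ , _ , eq = ∈-map⁻ (x ∷_) z∈ ; _ , _ , eq′ = ∈-map⁻ (x′ ∷_) z∈′ in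
                             List.∷-injectiveˡ (trans (sym eq) eq′))

    length-prefixAll : (xs : List A) (ys : List (List A)) → length (prefixAll xs ys) ≡ length xs * length ys
    length-prefixAll []       ys = refl
    length-prefixAll (x ∷ xs) ys =
      trans (List.length-++ (map (x ∷_) ys)) (cong₂ _+_ (List.length-map (x ∷_) ys) (length-prefixAll xs ys))

  nth : {A : Set} → A → List A → ℕ → A
  nth default []       k       = default
  nth default (x ∷ xs) zero    = x
  nth default (x ∷ xs) (suc k) = nth default xs k

  module _ {A : Set} (default : A) where

    nth-∈ : ∀ xs k → k < length xs → nth default xs k ∈ xs
    nth-∈ (x ∷ xs) zero    _         = here refl
    nth-∈ (x ∷ xs) (suc k) (s≤s k<)  = there (nth-∈ xs k k<)

    ∈-nth : ∀ xs {x} → x ∈ xs → Σ ℕ λ k → k < length xs × nth default xs k ≡ x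
    ∈-nth (x ∷ xs) (here refl) = 0 , s≤s z≤n , refl
    ∈-nth (y ∷ xs) (there x∈)  = let k , k< , eq = ∈-nth xs x∈ in suc k , s≤s k< , eq

    nth-injective : ∀ xs k k′ → Unique xs → k < length xs → k′ < length xs → nth default xs k ≡ nth default xs k′ → k ≡ k′
    nth-injective (x ∷ xs) zero    zero     _          _        _          _  = refl
    nth-injective (x ∷ xs) zero    (suc k′) (x∉ ∷ _)   _        (s≤s k′<) eq = ⊥-elim (All.lookup x∉ (nth-∈ xs k′ k′<) eq)
    nth-injective (x ∷ xs) (suc k) zero     (x∉ ∷ _)   (s≤s k<) _          eq = ⊥-elim (All.lookup x∉ (nth-∈ xs k k<) (sym eq))
    nth-injective (x ∷ xs) (suc k) (suc k′) (_ ∷ u)    (s≤s k<) (s≤s k′<) eq = cong suc (nth-injective xs k k′ u k< k′< eq)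

  listsOver : {A : Set} → List A → ℕ → List (List A)
  listsOver E zero    = [ [] ]
  listsOver E (suc k) = [] ∷ concatMap (λ e → map (e ∷_) (listsOver E k)) E

  ∈-listsOver : {A : Set} (E : List A) (k : ℕ) (s : List A) → length s ≤ k → All (_∈ E) s → s ∈ listsOver E k
  ∈-listsOver E zero    []      _         _          = here refl
  ∈-listsOver E (suc k) []      _         _          = here refl
  ∈-listsOver E (suc k) (x ∷ s) (s≤s s≤k) (x∈ ∷ s∈E) =
    there (∈-concatMap⁺ (λ e → map (e ∷_) (listsOver E k)) (lose x∈ (∈-map⁺ (x ∷_) (∈-listsOver E k s s≤k s∈E))))

  ⊆-map⁻ : {A B : Set} (h : A → B) {ys : List B} (zs : List A) → ys ⊆ map h zs →
    Σ (List A) λ zs′ → zs′ ⊆ zs × map h zs′ ≡ ys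
  ⊆-map⁻ h []       []            = [] , [] , refl
  ⊆-map⁻ h (z ∷ zs) (refl ∷ ys⊆)  = let zs′ , zs′⊆ , eq = ⊆-map⁻ h zs ys⊆ in z ∷ zs′ , refl ∷ zs′⊆ , cong (h z ∷_) eq
  ⊆-map⁻ h (z ∷ zs) (_ ∷ʳ ys⊆)    = let zs′ , zs′⊆ , eq = ⊆-map⁻ h zs ys⊆ in zs′ , z ∷ʳ zs′⊆ , eq

  AllPairs-⊆ : {A : Set} {R : A → A → Set} {xs ys : List A} → xs ⊆ ys → AllPairs R ys → AllPairs R xs
  AllPairs-⊆ []           []          = []
  AllPairs-⊆ (refl ∷ xs⊆) (Rx ∷ Rys)  = All.tabulate (All.lookup Rx ∘ Any-resp-⊆ xs⊆) ∷ AllPairs-⊆ xs⊆ Rys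
  AllPairs-⊆ (_ ∷ʳ xs⊆)   (_ ∷ Rys)   = AllPairs-⊆ xs⊆ Rys

  increasing-⊆ : (xs ys : List ℕ) → AllPairs _<_ xs → AllPairs _<_ ys → (∀ {x} → x ∈ xs → x ∈ ys) → xs ⊆ ys
  increasing-⊆ []       []       _          _          _    = []
  increasing-⊆ []       (y ∷ ys) _          (_ ∷ <ys)  _    = y ∷ʳ increasing-⊆ [] ys [] <ys (λ ())
  increasing-⊆ (x ∷ xs) []       _          _          xs∈ with () ← xs∈ (here refl)
  increasing-⊆ (x ∷ xs) (y ∷ ys) (x< ∷ <xs) (y< ∷ <ys) xs∈ with x ≟ y
  ... | yes refl = refl ∷ increasing-⊆ xs ys <xs <ys tail∈
    where
    tail∈ : ∀ {z} → z ∈ xs → z ∈ ys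
    tail∈ z∈ with xs∈ (there z∈)
    ... | here refl = ⊥-elim (ℕ.<-irrefl refl (All.lookup x< z∈))
    ... | there z∈′ = z∈′
  ... | no x≢y = y ∷ʳ increasing-⊆ (x ∷ xs) ys (x< ∷ <xs) <ys all∈
    where
    x∈ys : x ∈ ys
    x∈ys with xs∈ (here refl)
    ... | here x≡y  = ⊥-elim (x≢y x≡y)
    ... | there x∈ = x∈
    all∈ : ∀ {z} → z ∈ x ∷ xs → z ∈ ys
    all∈ (here refl) = x∈ys
    all∈ (there z∈) with xs∈ (there z∈)
    ... | there z∈′ = z∈′
    ... | here refl = ⊥-elim (ℕ.<-asym (All.lookup x< z∈) (All.lookup y< x∈ys))

  AllPairs-nth : {A : Set} {R : A → A → Set} (default : A) → ∀ xs i j → AllPairs R xs → i < j → j < length xs →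
    R (nth default xs i) (nth default xs j)
  AllPairs-nth default (x ∷ xs) zero    (suc j) (Rx ∷ _)   _         (s≤s j<) = All.lookup Rx (nth-∈ default xs j j<)
  AllPairs-nth default (x ∷ xs) (suc i) (suc j) (_ ∷ Rxs)  (s≤s i<j) (s≤s j<) = AllPairs-nth default xs i j Rxs i<j j<

module Generation (r : ℕ) where

  open import Data.Nat using (suc; _<_; _>_; _≤_; _<?_; _≤?_; _≟_; _∸_; pred)
  import Data.Nat.Properties as ℕ
  open import Data.Fin using (Fin)
  import Data.Fin as Fin
  open import Data.List using (List; []; _∷_; [_]; length; map; filter; _++_)
  import Data.List.Properties as List
  open import Data.List.Relation.Unary.All as All using (All; []; _∷_)
  open import Data.List.Relation.Unary.AllPairs as AllPairs using ([]; _∷_)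
  open import Data.List.Relation.Unary.Any using (here; there)
  open import Data.List.Membership.Propositional using (_∈_; _∉_)
  import Data.List.Membership.Propositional.Properties as ∈
  open import Data.List.Relation.Unary.Unique.Propositional using (Unique)
  open import Data.Maybe using (Maybe; just; nothing)
  import Data.Maybe.Properties as Maybe
  open import Data.Maybe.Relation.Unary.All using (nothing)
  open import Data.Product using (Σ; ∃; _×_; _,_; proj₁; proj₂)
  open import Data.Sum using (_⊎_; inj₁; inj₂; [_,_]′)
  open import Data.Unit using (⊤; tt)
  open import Data.Empty using (⊥; ⊥-elim)
  open import Function using (id; _∘_)
  open import Relation.Binary.PropositionalEquality
    using (_≡_; _≢_; refl; sym; trans; cong; cong₂; subst; module ≡-Reasoning)
  open import Relation.Nullary using (¬_; Dec; yes; no)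
  open import Relation.Nullary.Decidable using (dec-yes; dec-no)

  open Chains
  open ListOps

  -- Positions x < n are generated; σ is the
  -- partner map (σ x = x for singletons, for openers whose partner is not yet generated,
  -- and for x ≥ n); colour x is the colour of the arc opened at x; queue lists the
  -- unfinished openers in the order in which they will be closed.
  record Partial : Set where
    constructor mkPartial
    field
      σ      : ℕ → ℕ
      colour : ℕ → Maybe (Fin r)
      queue  : List ℕ
  open Partial public

  -- opening a p opens an arc of colour a and gives it place p in the closing order;
  -- closing closes the first arc of the queue.
  data Letter : Set where
    single  : Letter
    opening : Fin r → ℕ → Letter
    closing : Letter

  pair : (ℕ → ℕ) → ℕ → ℕ → ℕ → ℕ
  pair σ h n = update (update σ h n) n h

  extend : ℕ → Letter → Partial → Partial
  extend n single        g                        = g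
  extend n (opening a p) (mkPartial σ c q)        = mkPartial σ (update c n (just a)) (insert p n q)
  extend n closing       (mkPartial σ c [])       = mkPartial σ c []
  extend n closing       (mkPartial σ c (h ∷ q))  = mkPartial (pair σ h n) c q

  -- The head of a word is its last letter.
  build : List Letter → Partial
  build []      = mkPartial id (λ _ → nothing) []
  build (l ∷ w) = extend (length w) l (build w)

  Applicable : Letter → List ℕ → Set
  Applicable single        q       = ⊤
  Applicable (opening a p) q       = p ≤ length q
  Applicable closing       []      = ⊥
  Applicable closing       (_ ∷ _) = ⊤

  record WellFormed (n : ℕ) (g : Partial) : Set where
    field
      σ-beyond       : ∀ x → n ≤ x → σ g x ≡ x
      colour-beyond  : ∀ x → n ≤ x → colour g x ≡ nothing
      σ-involutive   : ∀ x → σ g (σ g x) ≡ x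
      queue-<        : ∀ x → x ∈ queue g → x < n
      queue-fixed    : ∀ x → x ∈ queue g → σ g x ≡ x
      queue-unique   : Unique (queue g)
      arc-coloured   : ∀ x → x < σ g x → ∃ λ a → colour g x ≡ just a
      queue-coloured : ∀ x → x ∈ queue g → ∃ λ a → colour g x ≡ just a
      uncoloured     : ∀ x → ¬ x < σ g x → x ∉ queue g → colour g x ≡ nothing

  σ-< : ∀ {n g} → WellFormed n g → ∀ x → x < n → σ g x < n
  σ-< {n} {g} wf x x<n with σ g x <? n
  ... | yes σx<n = σx<n
  ... | no  σx≮n = ⊥-elim (ℕ.<-irrefl refl (ℕ.<-≤-trans x<n (subst (n ≤_) (sym x≡σx) (ℕ.≮⇒≥ σx≮n))))
    where
    open WellFormed wf
    x≡σx : x ≡ σ g x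
    x≡σx = trans (sym (σ-involutive x)) (σ-beyond (σ g x) (ℕ.≮⇒≥ σx≮n))

  module Pair (σ : ℕ → ℕ) (h n : ℕ) where

    pair-right : pair σ h n n ≡ h
    pair-right = update-same _ n h

    pair-left : h ≢ n → pair σ h n h ≡ n
    pair-left h≢n = trans (update-other _ n h h h≢n) (update-same σ h n)

    pair-other : ∀ x → x ≢ n → x ≢ h → pair σ h n x ≡ σ x
    pair-other x x≢n x≢h = trans (update-other _ n h x x≢n) (update-other σ h n x x≢h)

  extend-wellFormed-single : ∀ n g → WellFormed n g → WellFormed (suc n) g
  extend-wellFormed-single n g wf = record
    { σ-beyond      = λ x n<x → σ-beyond x (ℕ.<⇒≤ n<x)
    ; colour-beyond = λ x n<x → colour-beyond x (ℕ.<⇒≤ n<x)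
    ; σ-involutive  = σ-involutive
    ; queue-<       = λ x x∈ → ℕ.m≤n⇒m≤1+n (queue-< x x∈)
    ; queue-fixed   = queue-fixed
    ; queue-unique  = queue-unique
    ; arc-coloured  = arc-coloured
    ; queue-coloured = queue-coloured
    ; uncoloured    = uncoloured
    }
    where open WellFormed wf

  extend-wellFormed-opening : ∀ n σ c q a p → WellFormed n (mkPartial σ c q) →
    WellFormed (suc n) (mkPartial σ (update c n (just a)) (insert p n q))
  extend-wellFormed-opening n σ c q a p wf = record
    { σ-beyond      = λ x n<x → σ-beyond x (ℕ.<⇒≤ n<x)
    ; colour-beyond = λ x n<x → trans (update-other c n _ x (ℕ.>⇒≢ n<x)) (colour-beyond x (ℕ.<⇒≤ n<x))
    ; σ-involutive  = σ-involutive
    ; queue-<       = λ x x∈ → [ (λ { refl → ℕ.n<1+n n }) , (λ x∈q → ℕ.m≤n⇒m≤1+n (queue-< x x∈q)) ]′ (∈-insert⁻ p n q x∈)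
    ; queue-fixed   = λ x x∈ → [ (λ { refl → σ-beyond n ℕ.≤-refl }) , queue-fixed x ]′ (∈-insert⁻ p n q x∈)
    ; queue-unique  = insert-unique p n q (λ n∈ → ℕ.<-irrefl refl (queue-< n n∈)) queue-unique
    ; arc-coloured  = λ x x<σx → subst (λ z → ∃ λ b → z ≡ just b) (sym (update-other c n _ x (arc≢n x x<σx))) (arc-coloured x x<σx)
    ; queue-coloured = queue-coloured′
    ; uncoloured    = λ x x≮σx x∉ → trans (update-other c n _ x (λ { refl → x∉ (∈-insert⁺ˡ p n q) }))
                                          (uncoloured x x≮σx (x∉ ∘ ∈-insert⁺ʳ p n q))
    }
    where
    open WellFormed wf
    arc≢n : ∀ x → x < σ x → x ≢ n
    arc≢n x x<σx refl = ℕ.<-irrefl (sym (σ-beyond x ℕ.≤-refl)) x<σx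
    queue-coloured′ : ∀ x → x ∈ insert p n q → ∃ λ b → update c n (just a) x ≡ just b
    queue-coloured′ x x∈ with x ≟ n
    ... | yes _   = a , refl
    ... | no  x≢n with ∈-insert⁻ p n q x∈
    ...   | inj₁ x≡n = ⊥-elim (x≢n x≡n)
    ...   | inj₂ x∈q = queue-coloured x x∈q

  extend-wellFormed-closing : ∀ n σ c h q → WellFormed n (mkPartial σ c (h ∷ q)) →
    WellFormed (suc n) (mkPartial (pair σ h n) c q)
  extend-wellFormed-closing n σ c h q wf = record
    { σ-beyond      = λ x n<x → trans (pair-other x (ℕ.>⇒≢ n<x) (beyond≢h x n<x)) (σ-beyond x (ℕ.<⇒≤ n<x))
    ; colour-beyond = λ x n<x → colour-beyond x (ℕ.<⇒≤ n<x)
    ; σ-involutive  = involutive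
    ; queue-<       = λ x x∈ → ℕ.m≤n⇒m≤1+n (queue-< x (there x∈))
    ; queue-fixed   = λ x x∈ → trans (pair-other x (ℕ.<⇒≢ (queue-< x (there x∈))) (λ x≡h → All.lookup h∉q x∈ (sym x≡h)))
                                     (queue-fixed x (there x∈))
    ; queue-unique  = AllPairs.tail queue-unique
    ; arc-coloured  = arc-coloured′
    ; queue-coloured = λ x x∈ → queue-coloured x (there x∈)
    ; uncoloured    = uncoloured′
    }
    where
    open WellFormed wf
    open Pair σ h n
    h<n : h < n
    h<n = queue-< h (here refl)
    h≢n : h ≢ n
    h≢n = ℕ.<⇒≢ h<n
    h∉q = AllPairs.head queue-unique
    beyond≢h : ∀ x → n < x → x ≢ h
    beyond≢h x n<x refl = ℕ.<-asym h<n n<x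
    involutive : ∀ x → pair σ h n (pair σ h n x) ≡ x
    involutive x = by-cases (λ x → pair σ h n (pair σ h n x) ≡ x) x n
      (λ { refl → trans (cong (pair σ h n) pair-right) (pair-left h≢n) })
      (λ x≢n → by-cases (λ x → pair σ h n (pair σ h n x) ≡ x) x h
        (λ { refl → trans (cong (pair σ h n) (pair-left h≢n)) pair-right })
        (λ x≢h → trans (cong (pair σ h n) (pair-other x x≢n x≢h))
          (trans (pair-other (σ x) (λ σx≡n → x≢n (trans (sym (σ-involutive x)) (trans (cong σ σx≡n) (σ-beyond n ℕ.≤-refl))))
                                   (λ σx≡h → x≢h (trans (sym (σ-involutive x)) (trans (cong σ σx≡h) (queue-fixed h (here refl))))))
                 (σ-involutive x))))
    arc-coloured′ : ∀ x → x < pair σ h n x → ∃ λ a → c x ≡ just a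
    arc-coloured′ x = by-cases (λ x → x < pair σ h n x → ∃ λ a → c x ≡ just a) x n
      (λ { refl x<h → ⊥-elim (ℕ.<-asym h<n (subst (x <_) pair-right x<h)) })
      (λ x≢n → by-cases (λ x → x < pair σ h n x → ∃ λ a → c x ≡ just a) x h
        (λ { refl _ → queue-coloured x (here refl) })
        (λ x≢h x< → arc-coloured x (subst (x <_) (pair-other x x≢n x≢h) x<)))
    uncoloured′ : ∀ x → ¬ x < pair σ h n x → x ∉ q → c x ≡ nothing
    uncoloured′ x = by-cases (λ x → ¬ x < pair σ h n x → x ∉ q → c x ≡ nothing) x n
      (λ { refl _ _ → colour-beyond x ℕ.≤-refl })
      (λ x≢n → by-cases (λ x → ¬ x < pair σ h n x → x ∉ q → c x ≡ nothing) x h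
        (λ { refl x≮ _ → ⊥-elim (x≮ (subst (x <_) (sym (pair-left h≢n)) h<n)) })
        (λ x≢h x≮ x∉ → uncoloured x (λ x< → x≮ (subst (x <_) (sym (pair-other x x≢n x≢h)) x<))
                                     (λ { (here x≡h) → x≢h x≡h ; (there x∈) → x∉ x∈ })))

  extend-wellFormed : ∀ n g l → WellFormed n g → Applicable l (queue g) → WellFormed (suc n) (extend n l g)
  extend-wellFormed n g                        single        wf _ = extend-wellFormed-single n g wf
  extend-wellFormed n (mkPartial σ c q)        (opening a p) wf _ = extend-wellFormed-opening n σ c q a p wf
  extend-wellFormed n (mkPartial σ c (h ∷ q))  closing       wf _ = extend-wellFormed-closing n σ c h q wf

  -- The openers x < t of the arcs that are open between t - 1 and t: first those closed at
  -- some y with t ≤ y < n, in the order of y, then the unfinished ones in closing order.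
  closedAcross : ℕ → ℕ → (ℕ → ℕ) → List ℕ
  closedAcross n t σ = map σ (filter (λ y → σ y <? t) (interval t (n ∸ t)))

  openAcross : ℕ → ℕ → Partial → List ℕ
  openAcross n t g = closedAcross n t (σ g) ++ filter (_<? t) (queue g)

  openAcross-< : ∀ n t g {y} → y ∈ openAcross n t g → y < t
  openAcross-< n t g y∈ with ∈.∈-++⁻ (closedAcross n t (σ g)) y∈
  ... | inj₂ y∈q = proj₂ (∈.∈-filter⁻ (_<? t) {xs = queue g} y∈q)
  ... | inj₁ y∈c with ∈.∈-map⁻ (σ g) y∈c
  ...   | z , z∈ , refl = proj₂ (∈.∈-filter⁻ (λ y → σ g y <? t) {xs = interval t (n ∸ t)} z∈)

  openAcross-now : ∀ n g → WellFormed n g → openAcross n n g ≡ queue g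
  openAcross-now n g wf rewrite ℕ.n∸n≡0 n =
    List.filter-all (_<? n) (All.tabulate (λ {x} → WellFormed.queue-< wf x))

  closedAcross-extend : ∀ n t σ → σ n ≡ n → t ≤ n → closedAcross (suc n) t σ ≡ closedAcross n t σ
  closedAcross-extend n t σ σn≡n t≤n = begin
    map σ (filter P? (interval t (suc n ∸ t)))               ≡⟨ cong (map σ ∘ filter P?) (interval-extend n t t≤n) ⟩
    map σ (filter P? (interval t (n ∸ t) ++ [ n ]))          ≡⟨ cong (map σ) (List.filter-++ P? (interval t (n ∸ t)) [ n ]) ⟩
    map σ (filter P? (interval t (n ∸ t)) ++ filter P? [ n ]) ≡⟨ cong (λ z → map σ (filter P? (interval t (n ∸ t)) ++ z)) n-rejected ⟩
    map σ (filter P? (interval t (n ∸ t)) ++ [])              ≡⟨ cong (map σ) (List.++-identityʳ _) ⟩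
    map σ (filter P? (interval t (n ∸ t)))                    ∎
    where
    open ≡-Reasoning
    P? = λ y → σ y <? t
    n-rejected : filter P? [ n ] ≡ []
    n-rejected = List.filter-reject P? {xs = []} (λ σn<t → ℕ.<-irrefl refl (ℕ.<-≤-trans (subst (_< t) σn≡n σn<t) t≤n))

  module OpenAcrossClosing (n t : ℕ) (σ : ℕ → ℕ) (c : ℕ → Maybe (Fin r)) (h : ℕ) (q : List ℕ)
    (wf : WellFormed n (mkPartial σ c (h ∷ q))) (t≤n : t ≤ n) where

    open WellFormed wf
    open Pair σ h n

    h<n : h < n
    h<n = queue-< h (here refl)

    earlier : List ℕ
    earlier = interval t (n ∸ t)

    ∈-earlier : ∀ y → y ∈ earlier → t ≤ y × y < n
    ∈-earlier y y∈ = let t≤y , y< = ∈-interval⁻ t (n ∸ t) y∈ in t≤y , subst (y <_) (ℕ.m+[n∸m]≡n t≤n) y<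

    pair-earlier : ∀ y → t ≤ y → y < n → σ y < t → pair σ h n y ≡ σ y
    pair-earlier y t≤y y<n σy<t = pair-other y (ℕ.<⇒≢ y<n)
      (λ { refl → ℕ.<-irrefl refl (ℕ.<-≤-trans (subst (_< t) (queue-fixed y (here refl)) σy<t) t≤y) })

    pair-earlier⁻ : ∀ y → t ≤ y → y < n → pair σ h n y < t → σ y < t
    pair-earlier⁻ y t≤y y<n pσy<t with y ≟ h
    ... | yes refl = ⊥-elim (ℕ.<-irrefl refl (ℕ.<-≤-trans (subst (_< t) (pair-left (ℕ.<⇒≢ h<n)) pσy<t) t≤n))
    ... | no  y≢h  = subst (_< t) (pair-other y (ℕ.<⇒≢ y<n) y≢h) pσy<t

    closedAcross-pair : map (pair σ h n) (filter (λ y → pair σ h n y <? t) earlier) ≡ closedAcross n t σ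
    closedAcross-pair = sym (map-filter-cong (λ y → σ y <? t) (λ y → pair σ h n y <? t) σ (pair σ h n) earlier
      (λ y y∈ → let t≤y , y<n = ∈-earlier y y∈ in
        (λ σy<t → subst (_< t) (sym (pair-earlier y t≤y y<n σy<t)) σy<t) , pair-earlier⁻ y t≤y y<n)
      (λ y y∈ σy<t → let t≤y , y<n = ∈-earlier y y∈ in sym (pair-earlier y t≤y y<n σy<t)))

    closedAcross-now : map (pair σ h n) (filter (λ y → pair σ h n y <? t) [ n ]) ++ filter (_<? t) q ≡ filter (_<? t) (h ∷ q)
    closedAcross-now = by-decision (h <? t)
      where
      P′? = λ y → pair σ h n y <? t
      by-decision : Dec (h < t) → map (pair σ h n) (filter P′? [ n ]) ++ filter (_<? t) q ≡ filter (_<? t) (h ∷ q)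
      by-decision (yes h<t) =
        trans (cong (λ z → map (pair σ h n) z ++ filter (_<? t) q) (List.filter-accept P′? {xs = []} (subst (_< t) (sym pair-right) h<t)))
              (trans (cong (_∷ filter (_<? t) q) pair-right) (sym (List.filter-accept (_<? t) {xs = q} h<t)))
      by-decision (no h≮t) =
        trans (cong (λ z → map (pair σ h n) z ++ filter (_<? t) q) (List.filter-reject P′? {xs = []} (λ pn<t → h≮t (subst (_< t) pair-right pn<t))))
              (sym (List.filter-reject (_<? t) {xs = q} h≮t))

    openAcross-closing : openAcross (suc n) t (mkPartial (pair σ h n) c q) ≡ openAcross n t (mkPartial σ c (h ∷ q))
    openAcross-closing = begin
      map σ′ (filter P′? (interval t (suc n ∸ t))) ++ filter (_<? t) q
        ≡⟨ cong (λ z → map σ′ (filter P′? z) ++ filter (_<? t) q) (interval-extend n t t≤n) ⟩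
      map σ′ (filter P′? (earlier ++ [ n ])) ++ filter (_<? t) q
        ≡⟨ cong (λ z → map σ′ z ++ filter (_<? t) q) (List.filter-++ P′? earlier [ n ]) ⟩
      map σ′ (filter P′? earlier ++ filter P′? [ n ]) ++ filter (_<? t) q
        ≡⟨ cong (_++ filter (_<? t) q) (List.map-++ σ′ (filter P′? earlier) _) ⟩
      (map σ′ (filter P′? earlier) ++ map σ′ (filter P′? [ n ])) ++ filter (_<? t) q
        ≡⟨ List.++-assoc (map σ′ (filter P′? earlier)) _ _ ⟩
      map σ′ (filter P′? earlier) ++ (map σ′ (filter P′? [ n ]) ++ filter (_<? t) q)
        ≡⟨ cong₂ _++_ closedAcross-pair closedAcross-now ⟩
      closedAcross n t σ ++ filter (_<? t) (h ∷ q) ∎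
      where
      open ≡-Reasoning
      σ′ = pair σ h n
      P′? = λ y → σ′ y <? t

  openAcross-extend : ∀ n g l t → WellFormed n g → Applicable l (queue g) → t ≤ n →
    openAcross (suc n) t (extend n l g) ≡ openAcross n t g
  openAcross-extend n g single t wf _ t≤n =
    cong (_++ filter (_<? t) (queue g)) (closedAcross-extend n t (σ g) (WellFormed.σ-beyond wf n ℕ.≤-refl) t≤n)
  openAcross-extend n (mkPartial σ c q) (opening a p) t wf _ t≤n =
    cong₂ _++_ (closedAcross-extend n t σ (WellFormed.σ-beyond wf n ℕ.≤-refl) t≤n)
               (filter-insert-reject (_<? t) p n q (λ n<t → ℕ.<-irrefl refl (ℕ.<-≤-trans n<t t≤n)))
  openAcross-extend n (mkPartial σ c (h ∷ q)) closing t wf _ t≤n = OpenAcrossClosing.openAcross-closing n t σ c h q wf t≤n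

  -- Monochromatic crossings and nestings

  data Kind : Set where
    crossing nesting : Kind

  order : Kind → ℕ → ℕ → Set
  order crossing = _<_
  order nesting  = _>_

  order? : ∀ k x y → Dec (order k x y)
  order? crossing x y = x <? y
  order? nesting  x y = y <? x

  Pattern : Kind → (ℕ → Maybe (Fin r)) → ℕ → ℕ → Set
  Pattern k c = Monochromatic c (order k)

  -- A monochromatic (suc m)-crossing or -nesting among the arcs generated before time n,
  -- unfinished arcs counting as closed after all positions in their closing order.
  HasPattern : Kind → ℕ → Partial → ℕ → Set
  HasPattern k n g m = Σ ℕ λ t → t ≤ n × Chain (Pattern k (colour g)) nothing (suc m) (openAcross n t g)

  Pattern-recolour : ∀ k {c c′ : ℕ → Maybe (Fin r)} {x y} → c x ≡ c′ x → c y ≡ c′ y → Pattern k c x y → Pattern k c′ x y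
  Pattern-recolour k cx≡ cy≡ (cx≡cy , xy) = trans (sym cx≡) (trans cx≡cy cy≡) , xy

  colour-extend : ∀ n g l x → x < n → colour (extend n l g) x ≡ colour g x
  colour-extend n g                        single        x x<n = refl
  colour-extend n (mkPartial σ c q)        (opening a p) x x<n = update-other c n _ x (ℕ.<⇒≢ x<n)
  colour-extend n (mkPartial σ c [])       closing       x x<n = refl
  colour-extend n (mkPartial σ c (h ∷ q))  closing       x x<n = refl

  Chain-recolour : ∀ k n t (c c′ : ℕ → Maybe (Fin r)) xs m → t ≤ n → (∀ x → x < n → c x ≡ c′ x) →
    All (_< t) xs → Chain (Pattern k c) nothing m xs → Chain (Pattern k c′) nothing m xs
  Chain-recolour k n t c c′ xs m t≤n c≡c′ xs<t =
    Chain-mono (_< t) (λ {x} {y} x<t y<t → Pattern-recolour k (c≡c′ x (ℕ.<-≤-trans x<t t≤n)) (c≡c′ y (ℕ.<-≤-trans y<t t≤n)))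
      nothing xs<t

  HasPattern-extend⁺ : ∀ k n g l m → WellFormed n g → Applicable l (queue g) →
    HasPattern k n g m → HasPattern k (suc n) (extend n l g) m
  HasPattern-extend⁺ k n g l m wf app (t , t≤n , ch) = t , ℕ.m≤n⇒m≤1+n t≤n ,
    subst (Chain (Pattern k (colour (extend n l g))) nothing (suc m)) (sym (openAcross-extend n g l t wf app t≤n))
      (Chain-recolour k n t (colour g) (colour (extend n l g)) _ _ t≤n (λ x x<n → sym (colour-extend n g l x x<n))
        (All.tabulate (openAcross-< n t g)) ch)

  HasPattern-extend⁻ : ∀ k n g l m → WellFormed n g → Applicable l (queue g) → HasPattern k (suc n) (extend n l g) m →
    HasPattern k n g m ⊎ Chain (Pattern k (colour (extend n l g))) nothing (suc m) (queue (extend n l g))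
  HasPattern-extend⁻ k n g l m wf app (t , t≤n+1 , ch) with t ≟ suc n
  ... | yes refl = inj₂ (subst (Chain _ nothing (suc m)) (openAcross-now (suc n) (extend n l g) (extend-wellFormed n g l wf app)) ch)
  ... | no  t≢n+1 = inj₁ (t , t≤n , Chain-recolour k n t (colour (extend n l g)) (colour g) _ _ t≤n (colour-extend n g l)
                          (All.tabulate (openAcross-< n t g)) (subst (Chain _ nothing (suc m)) (openAcross-extend n g l t wf app t≤n) ch))
    where
    t≤n : t ≤ n
    t≤n = ℕ.≤-pred (ℕ.≤∧≢⇒< t≤n+1 t≢n+1)

  HasPattern-now : ∀ k n g m → WellFormed n g → Chain (Pattern k (colour g)) nothing (suc m) (queue g) → HasPattern k n g m
  HasPattern-now k n g m wf ch = n , ℕ.≤-refl , subst (Chain _ nothing (suc m)) (sym (openAcross-now n g wf)) ch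

  -- The queue, each unfinished opener replaced by its colour and its rank among the
  -- unfinished openers.
  Abstract : Set
  Abstract = List (Maybe (Fin r) × ℕ)

  abstractionOf : (ℕ → Maybe (Fin r)) → List ℕ → Abstract
  abstractionOf c q = map (λ x → c x , rank x q) q

  abstraction : Partial → Abstract
  abstraction g = abstractionOf (colour g) (queue g)

  shiftDown : ℕ → ℕ → ℕ
  shiftDown l x with l <? x
  ... | yes _ = pred x
  ... | no  _ = x

  shiftDown-above : ∀ l x → l < x → shiftDown l x ≡ pred x
  shiftDown-above l x l<x rewrite dec-yes (l <? x) l<x .proj₂ = refl

  shiftDown-below : ∀ l x → ¬ l < x → shiftDown l x ≡ x
  shiftDown-below l x l≮x rewrite dec-no (l <? x) l≮x = refl

  abstractStep : Letter → Abstract → Maybe Abstract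
  abstractStep single        s = just s
  abstractStep (opening a p) s with p ≤? length s
  ... | yes _ = just (insert p (just a , length s) s)
  ... | no  _ = nothing
  abstractStep closing []            = nothing
  abstractStep closing ((_ , l) ∷ s) = just (map (λ (b , x) → b , shiftDown l x) s)

  abstractStep-opening : ∀ n σ c q a p → WellFormed n (mkPartial σ c q) → p ≤ length q →
    abstractStep (opening a p) (abstractionOf c q) ≡ just (abstractionOf (update c n (just a)) (insert p n q))
  abstractStep-opening n σ c q a p wf p≤ rewrite dec-yes (p ≤? length (abstractionOf c q)) (subst (p ≤_) (sym (List.length-map _ q)) p≤) .proj₂ =
    cong just (sym (trans (map-insert _ p n q) (cong₂ (insert p) (cong₂ _,_ (update-same c n (just a)) rank-new) (List.map-cong-local (All.tabulate old)))))
    where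
    open WellFormed wf
    rank-new : rank n (insert p n q) ≡ length (abstractionOf c q)
    rank-new = trans (cong length (trans (filter-insert-reject (_<? n) p n q (ℕ.<-irrefl refl))
                                         (List.filter-all (_<? n) (All.tabulate (queue-< _)))))
                     (sym (List.length-map _ q))
    old : ∀ {x} → x ∈ q → (update c n (just a) x , rank x (insert p n q)) ≡ (c x , rank x q)
    old {x} x∈ = cong₂ _,_ (update-other c n _ x (ℕ.<⇒≢ (queue-< x x∈)))
                          (cong length (filter-insert-reject (_<? x) p n q (λ n<x → ℕ.<-asym n<x (queue-< x x∈))))

  abstractStep-closing : ∀ n σ c h q → WellFormed n (mkPartial σ c (h ∷ q)) →
    abstractStep closing (abstractionOf c (h ∷ q)) ≡ just (abstractionOf c q)
  abstractStep-closing n σ c h q wf = cong just (trans (sym (List.map-∘ q)) (List.map-cong-local (All.tabulate rank-after)))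
    where
    open WellFormed wf
    rank-after : ∀ {x} → x ∈ q → (c x , shiftDown (rank h (h ∷ q)) (rank x (h ∷ q))) ≡ (c x , rank x q)
    rank-after {x} x∈ with h <? x
    ... | yes h<x = cong (c x ,_) (trans (shiftDown-above _ _ (rank-strict h x (h ∷ q) (here refl) h<x))
                                         (cong pred (rank-below x h q h<x)))
    ... | no  h≮x = cong (c x ,_) (trans (shiftDown-below _ _ (λ rh<rx → ℕ.<⇒≱ rh<rx (rank-mono x h (h ∷ q) (ℕ.<⇒≤ x<h))))
                                         (rank-above x h q h≮x))
      where
      x<h : x < h
      x<h = ℕ.≤∧≢⇒< (ℕ.≮⇒≥ h≮x) (λ x≡h → All.lookup (AllPairs.head queue-unique) x∈ (sym x≡h))

  abstractStep-extend : ∀ n g l → WellFormed n g → Applicable l (queue g) →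
    abstractStep l (abstraction g) ≡ just (abstraction (extend n l g))
  abstractStep-extend n g                        single        wf _  = refl
  abstractStep-extend n (mkPartial σ c q)        (opening a p) wf p≤ = abstractStep-opening n σ c q a p wf p≤
  abstractStep-extend n (mkPartial σ c (h ∷ q))  closing       wf _  = abstractStep-closing n σ c h q wf

  AbstractPattern : Kind → Maybe (Fin r) × ℕ → Maybe (Fin r) × ℕ → Set
  AbstractPattern k = Monochromatic proj₁ (λ e e′ → order k (proj₂ e) (proj₂ e′))

  abstractPattern? : ∀ k x y → Dec (AbstractPattern k x y)
  abstractPattern? k = monochromatic? (Maybe.≡-dec Fin._≟_) proj₁ (λ e e′ → order? k (proj₂ e) (proj₂ e′))

  order-rank⁻ : ∀ k x y q → order k (rank x q) (rank y q) → order k x y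
  order-rank⁻ crossing x y q = rank-<⇒< x y q
  order-rank⁻ nesting  x y q = rank-<⇒< y x q

  order-rank⁺ : ∀ k x y q → x ∈ q → y ∈ q → order k x y → order k (rank x q) (rank y q)
  order-rank⁺ crossing x y q x∈ y∈ = rank-strict x y q x∈
  order-rank⁺ nesting  x y q x∈ y∈ = rank-strict y x q y∈

  abstraction-pattern⁻ : ∀ k g m → Chain (AbstractPattern k) nothing m (abstraction g) → Chain (Pattern k (colour g)) nothing m (queue g)
  abstraction-pattern⁻ k g m =
    Chain-map⁻ (λ x → colour g x , rank x (queue g)) (λ {x} {y} (c≡ , o) → c≡ , order-rank⁻ k x y (queue g) o) (queue g)

  abstraction-pattern⁺ : ∀ k g m → Chain (Pattern k (colour g)) nothing m (queue g) → Chain (AbstractPattern k) nothing m (abstraction g)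
  abstraction-pattern⁺ k g m ch = Chain-map⁺ (λ x → colour g x , rank x (queue g)) (λ r → r) (queue g)
    (Chain-mono (_∈ queue g) (λ {x} {y} x∈ y∈ (c≡ , o) → c≡ , order-rank⁺ k x y (queue g) x∈ y∈ o) nothing (All.tabulate id) ch)

  _≈_ : Partial → Partial → Set
  g ≈ g′ = (∀ x → σ g x ≡ σ g′ x) × (∀ x → colour g x ≡ colour g′ x) × queue g ≡ queue g′

  ≈-refl : ∀ {g} → g ≈ g
  ≈-refl = (λ _ → refl) , (λ _ → refl) , refl

  ≈-sym : ∀ {g g′} → g ≈ g′ → g′ ≈ g
  ≈-sym (σ≡ , c≡ , q≡) = (λ x → sym (σ≡ x)) , (λ x → sym (c≡ x)) , sym q≡

  ≈-trans : ∀ {g g′ g″} → g ≈ g′ → g′ ≈ g″ → g ≈ g″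
  ≈-trans (σ≡ , c≡ , q≡) (σ≡′ , c≡′ , q≡′) = (λ x → trans (σ≡ x) (σ≡′ x)) , (λ x → trans (c≡ x) (c≡′ x)) , trans q≡ q≡′

  ≈-extend : ∀ n l {g g′} → g ≈ g′ → extend n l g ≈ extend n l g′
  ≈-extend n single        g≈g′ = g≈g′
  ≈-extend n (opening a p) {mkPartial _ _ q} {mkPartial _ _ .q}      (σ≡ , c≡ , refl) = σ≡ , update-cong c≡ n (just a) , refl
  ≈-extend n closing       {mkPartial _ _ []} {mkPartial _ _ .[]}     (σ≡ , c≡ , refl) = σ≡ , c≡ , refl
  ≈-extend n closing       {mkPartial _ _ (h ∷ q)} {mkPartial _ _ .(h ∷ q)} (σ≡ , c≡ , refl) =
    update-cong (update-cong σ≡ h n) n h , c≡ , refl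

  ≈-wellFormed : ∀ n {g g′} → g ≈ g′ → WellFormed n g → WellFormed n g′
  ≈-wellFormed n {g} {g′} (σ≡ , c≡ , q≡) wf = record
    { σ-beyond      = λ x n≤x → trans (sym (σ≡ x)) (σ-beyond x n≤x)
    ; colour-beyond = λ x n≤x → trans (sym (c≡ x)) (colour-beyond x n≤x)
    ; σ-involutive  = λ x → trans (sym (σ≡ (σ g′ x))) (trans (cong (σ g) (sym (σ≡ x))) (σ-involutive x))
    ; queue-<       = λ x x∈ → queue-< x (∈q x∈)
    ; queue-fixed   = λ x x∈ → trans (sym (σ≡ x)) (queue-fixed x (∈q x∈))
    ; queue-unique  = subst Unique q≡ queue-unique
    ; arc-coloured  = λ x x< → let a , eq = arc-coloured x (subst (x <_) (sym (σ≡ x)) x<) in a , trans (sym (c≡ x)) eq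
    ; queue-coloured = λ x x∈ → let a , eq = queue-coloured x (∈q x∈) in a , trans (sym (c≡ x)) eq
    ; uncoloured    = λ x x≮ x∉ → trans (sym (c≡ x)) (uncoloured x (λ x< → x≮ (subst (x <_) (σ≡ x) x<)) (λ x∈ → x∉ (subst (x ∈_) q≡ x∈)))
    }
    where
    open WellFormed wf
    ∈q : ∀ {x} → x ∈ queue g′ → x ∈ queue g
    ∈q = subst (_ ∈_) (sym q≡)

  ≈-abstraction : ∀ {g g′} → g ≈ g′ → abstraction g ≡ abstraction g′
  ≈-abstraction {g} {g′} (σ≡ , c≡ , q≡) rewrite q≡ = List.map-cong (λ x → cong (_, rank x (queue g′)) (c≡ x)) (queue g′)

  ≈-openAcross : ∀ n t {g g′} → g ≈ g′ → openAcross n t g ≡ openAcross n t g′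
  ≈-openAcross n t {g} {g′} (σ≡ , c≡ , q≡) = cong₂ _++_
    (map-filter-cong (λ y → σ g y <? t) (λ y → σ g′ y <? t) (σ g) (σ g′) (interval t (n ∸ t))
       (λ y _ → subst (_< t) (σ≡ y) , subst (_< t) (sym (σ≡ y))) (λ y _ _ → σ≡ y))
    (cong (filter (_<? t)) q≡)

  ≈-HasPattern : ∀ k n m {g g′} → g ≈ g′ → HasPattern k n g m → HasPattern k n g′ m
  ≈-HasPattern k n m {g} {g′} g≈g′@(_ , c≡ , _) (t , t≤n , ch) = t , t≤n ,
    subst (Chain (Pattern k (colour g′)) nothing (suc m)) (≈-openAcross n t g≈g′)
      (Chain-mono (λ _ → ⊤) (λ {x} {y} _ _ → Pattern-recolour k (c≡ x) (c≡ y)) nothing (All.tabulate (λ _ → tt)) ch)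

module Retraction (r : ℕ) (default : Fin r) where

  open import Data.Nat using (suc; _<_; _≤_; _≟_)
  import Data.Nat.Properties as ℕ
  open import Data.List using (List; _∷_; length)
  open import Data.List.Relation.Unary.All as All using ()
  open import Data.List.Relation.Unary.AllPairs using (_∷_)
  open import Data.List.Relation.Unary.Any using (here; there)
  open import Data.List.Membership.Propositional using (_∈_; _∉_)
  open import Data.Maybe using (Maybe; just; nothing; fromMaybe)
  open import Data.Product using (∃; _×_; _,_; proj₁; proj₂)
  open import Data.Empty using (⊥-elim)
  open import Relation.Binary.PropositionalEquality using (_≡_; _≢_; refl; sym; trans; cong; subst)
  open import Relation.Nullary using (Dec; yes; no)
  open import Relation.Nullary.Decidable using (dec-yes; dec-no)

  open ListOps
  open Generation r

  unpair : (ℕ → ℕ) → ℕ → ℕ → ℕ → ℕ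
  unpair σ h n = update (update σ n n) h h

  retractUnmatched : ℕ → (ℕ → ℕ) → (ℕ → Maybe (Fin r)) → List ℕ → Maybe ℕ → Letter × Partial
  retractUnmatched n σ c q (just p) = opening (fromMaybe default (c n)) p , mkPartial σ (update c n nothing) (remove n q)
  retractUnmatched n σ c q nothing  = single , mkPartial σ c q

  retractWith : (n : ℕ) (σ : ℕ → ℕ) (c : ℕ → Maybe (Fin r)) (q : List ℕ) → Dec (σ n ≡ n) → Letter × Partial
  retractWith n σ c q (no  _) = closing , mkPartial (unpair σ (σ n) n) c (σ n ∷ q)
  retractWith n σ c q (yes _) = retractUnmatched n σ c q (position n q)

  -- The letter that generated position n, and the partial matching before it.
  retract : ℕ → Partial → Letter × Partial
  retract n g = retractWith n (σ g) (colour g) (queue g) (σ g n ≟ n)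

  retract-extend : ∀ n g l → WellFormed n g → Applicable l (queue g) →
    proj₁ (retract n (extend n l g)) ≡ l × proj₂ (retract n (extend n l g)) ≈ g
  retract-extend n g single wf _
    rewrite dec-yes (σ g n ≟ n) (WellFormed.σ-beyond wf n ℕ.≤-refl) .proj₂
          | position-∉ n (queue g) (λ n∈ → ℕ.<-irrefl refl (WellFormed.queue-< wf n n∈)) = refl , ≈-refl
  retract-extend n (mkPartial σ c q) (opening a p) wf p≤
    rewrite dec-yes (σ n ≟ n) (WellFormed.σ-beyond wf n ℕ.≤-refl) .proj₂
          | position-insert n p q (λ n∈ → ℕ.<-irrefl refl (WellFormed.queue-< wf n n∈)) p≤ =
    cong (λ z → opening (fromMaybe default z) p) (update-same c n (just a)) ,
    (λ _ → refl) , colour-restored , remove-insert n p q n∉q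
    where
    n∉q : n ∉ q
    n∉q n∈ = ℕ.<-irrefl refl (WellFormed.queue-< wf n n∈)
    colour-restored : ∀ x → update (update c n (just a)) n nothing x ≡ c x
    colour-restored x with x ≟ n
    ... | yes refl = sym (WellFormed.colour-beyond wf x ℕ.≤-refl)
    ... | no  x≢n  = update-other c n (just a) x x≢n
  retract-extend n (mkPartial σ c (h ∷ q)) closing wf _
    rewrite dec-no (pair σ h n n ≟ n) (λ eq → ℕ.<⇒≢ (WellFormed.queue-< wf h (here refl)) (trans (sym (Pair.pair-right σ h n)) eq)) =
    refl , σ-restored , (λ _ → refl) , cong (_∷ q) pair-right
    where
    open WellFormed wf
    open Pair σ h n
    σ-restored : ∀ x → unpair (pair σ h n) (pair σ h n n) n x ≡ σ x
    σ-restored x rewrite pair-right with x ≟ h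
    ... | yes refl = sym (queue-fixed x (here refl))
    ... | no  x≢h with x ≟ n
    ...   | yes refl = sym (σ-beyond x ℕ.≤-refl)
    ...   | no  x≢n  = pair-other x x≢n x≢h

  IsRetraction : ℕ → Partial → Letter × Partial → Set
  IsRetraction n g (l , g₀) = WellFormed n g₀ × Applicable l (queue g₀) × extend n l g₀ ≈ g

  from-beyond : (P : ℕ → Set) → ∀ n → P n → (∀ x → suc n ≤ x → P x) → ∀ x → n ≤ x → P x
  from-beyond P n Pn P-beyond x n≤x =
    by-cases P x n (λ { refl → Pn }) (λ x≢n → P-beyond x (ℕ.≤∧≢⇒< n≤x (λ n≡x → x≢n (sym n≡x))))

  extend-retract-single : ∀ n σ c q → position n q ≡ nothing → σ n ≡ n → WellFormed (suc n) (mkPartial σ c q) →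
    IsRetraction n (mkPartial σ c q) (retractUnmatched n σ c q nothing)
  extend-retract-single n σ c q pos≡ σn≡n wf = wf₀ , _ , ≈-refl
    where
    open WellFormed wf
    n∉q : n ∉ q
    n∉q = position-nothing n q pos≡
    wf₀ : WellFormed n (mkPartial σ c q)
    wf₀ = record
      { σ-beyond      = from-beyond (λ x → σ x ≡ x) n σn≡n σ-beyond
      ; colour-beyond = from-beyond (λ x → c x ≡ nothing) n (uncoloured n (λ n< → ℕ.<-irrefl (sym σn≡n) n<) n∉q) colour-beyond
      ; σ-involutive  = σ-involutive
      ; queue-<       = λ x x∈ → ℕ.≤∧≢⇒< (ℕ.≤-pred (queue-< x x∈)) (λ { refl → n∉q x∈ })
      ; queue-fixed   = queue-fixed
      ; queue-unique  = queue-unique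
      ; arc-coloured  = arc-coloured
      ; queue-coloured = queue-coloured
      ; uncoloured    = uncoloured
      }

  extend-retract-opening : ∀ n σ c q p → position n q ≡ just p → σ n ≡ n → WellFormed (suc n) (mkPartial σ c q) →
    IsRetraction n (mkPartial σ c q) (retractUnmatched n σ c q (just p))
  extend-retract-opening n σ c q p pos≡ σn≡n wf = wf₀ , p≤ , (λ _ → refl) , colour-restored , insert-remove
    where
    open WellFormed wf
    n∈q = proj₁ (position-just n q p pos≡)
    p< = proj₁ (proj₂ (position-just n q p pos≡))
    insert-remove = proj₂ (proj₂ (position-just n q p pos≡))
    q₀-unique = proj₁ (remove-unique n q queue-unique)
    n∉q₀ = proj₂ (remove-unique n q queue-unique)
    c₀ = update c n nothing
    arc≢n : ∀ x → x < σ x → x ≢ n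
    arc≢n x x<σx refl = ℕ.<-irrefl (sym σn≡n) x<σx
    q₀≢n : ∀ x → x ∈ remove n q → x ≢ n
    q₀≢n x x∈ refl = n∉q₀ x∈
    wf₀ : WellFormed n (mkPartial σ c₀ (remove n q))
    wf₀ = record
      { σ-beyond      = from-beyond (λ x → σ x ≡ x) n σn≡n σ-beyond
      ; colour-beyond = from-beyond (λ x → c₀ x ≡ nothing) n (update-same c n nothing)
                          (λ x n<x → trans (update-other c n nothing x (ℕ.>⇒≢ n<x)) (colour-beyond x n<x))
      ; σ-involutive  = σ-involutive
      ; queue-<       = λ x x∈ → ℕ.≤∧≢⇒< (ℕ.≤-pred (queue-< x (∈-remove⁻ n q x∈))) (q₀≢n x x∈)
      ; queue-fixed   = λ x x∈ → queue-fixed x (∈-remove⁻ n q x∈)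
      ; queue-unique  = q₀-unique
      ; arc-coloured  = λ x x< → subst (λ z → ∃ λ a → z ≡ just a) (sym (update-other c n nothing x (arc≢n x x<))) (arc-coloured x x<)
      ; queue-coloured = λ x x∈ → subst (λ z → ∃ λ a → z ≡ just a) (sym (update-other c n nothing x (q₀≢n x x∈)))
                                        (queue-coloured x (∈-remove⁻ n q x∈))
      ; uncoloured    = λ x x≮ x∉ → by-cases (λ x → c₀ x ≡ nothing) x n (λ { refl → update-same c x nothing })
                          (λ x≢n → trans (update-other c n nothing x x≢n) (uncoloured x x≮ (λ x∈ → x∉ (∈-remove⁺ n q x∈ x≢n))))
      }
    p≤ : p ≤ length (remove n q)
    p≤ = ℕ.≤-pred (subst (suc p ≤_) (length-remove n q n∈q) p<)
    coloured : ∀ m → c n ≡ m → just (fromMaybe default m) ≡ m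
    coloured (just a) _   = refl
    coloured nothing  eq with () ← trans (sym eq) (proj₂ (queue-coloured n n∈q))
    colour-restored : ∀ x → update c₀ n (just (fromMaybe default (c n))) x ≡ c x
    colour-restored x = by-cases (λ x → update c₀ n _ x ≡ c x) x n
      (λ { refl → trans (update-same c₀ x _) (coloured (c x) refl) })
      (λ x≢n → trans (update-other c₀ n _ x x≢n) (update-other c n nothing x x≢n))

  module Unpair (σ : ℕ → ℕ) (h n : ℕ) (h≢n : h ≢ n) where

    unpair-left : unpair σ h n h ≡ h
    unpair-left = update-same _ h h

    unpair-right : unpair σ h n n ≡ n
    unpair-right = trans (update-other _ h h n (λ n≡h → h≢n (sym n≡h))) (update-same σ n n)

    unpair-other : ∀ x → x ≢ n → x ≢ h → unpair σ h n x ≡ σ x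
    unpair-other x x≢n x≢h = trans (update-other _ h h x x≢h) (update-other σ n n x x≢n)

  extend-retract-closing : ∀ n σ c q (σn≢n : σ n ≢ n) → WellFormed (suc n) (mkPartial σ c q) →
    IsRetraction n (mkPartial σ c q) (retractWith n σ c q (no σn≢n))
  extend-retract-closing n σ c q σn≢n wf = wf₀ , _ , σ-restored , (λ _ → refl) , refl
    where
    open WellFormed wf
    h = σ n
    h<n : h < n
    h<n = ℕ.≤∧≢⇒< (ℕ.≤-pred (σ-< wf n (ℕ.n<1+n n))) σn≢n
    h≢n : h ≢ n
    h≢n = ℕ.<⇒≢ h<n
    open Unpair σ h n h≢n
    σh≡n : σ h ≡ n
    σh≡n = σ-involutive n
    n∉q : n ∉ q
    n∉q n∈ = σn≢n (queue-fixed n n∈)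
    h∉q : h ∉ q
    h∉q h∈ = h≢n (trans (sym (queue-fixed h h∈)) σh≡n)
    σ₀ = unpair σ h n
    cn≡nothing : c n ≡ nothing
    cn≡nothing = uncoloured n (λ n<h → ℕ.<-asym n<h h<n) n∉q
    σ₀-involutive : ∀ x → σ₀ (σ₀ x) ≡ x
    σ₀-involutive x = by-cases (λ x → σ₀ (σ₀ x) ≡ x) x h (λ { refl → trans (cong σ₀ unpair-left) unpair-left })
      (λ x≢h → by-cases (λ x → σ₀ (σ₀ x) ≡ x) x n (λ { refl → trans (cong σ₀ unpair-right) unpair-right })
        (λ x≢n → trans (cong σ₀ (unpair-other x x≢n x≢h))
          (trans (unpair-other (σ x) (λ σx≡n → x≢h (trans (sym (σ-involutive x)) (cong σ σx≡n)))
                                     (λ σx≡h → x≢n (trans (sym (σ-involutive x)) (trans (cong σ σx≡h) σh≡n))))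
                 (σ-involutive x))))
    arc-coloured₀ : ∀ x → x < σ₀ x → ∃ λ a → c x ≡ just a
    arc-coloured₀ x = by-cases (λ x → x < σ₀ x → ∃ λ a → c x ≡ just a) x h
      (λ { refl x< → ⊥-elim (ℕ.<-irrefl (sym unpair-left) x<) })
      (λ x≢h → by-cases (λ x → x < σ₀ x → ∃ λ a → c x ≡ just a) x n (λ { refl x< → ⊥-elim (ℕ.<-irrefl (sym unpair-right) x<) })
        (λ x≢n x< → arc-coloured x (subst (x <_) (unpair-other x x≢n x≢h) x<)))
    wf₀ : WellFormed n (mkPartial σ₀ c (h ∷ q))
    wf₀ = record
      { σ-beyond      = from-beyond (λ x → σ₀ x ≡ x) n unpair-right
                          (λ x n<x → trans (unpair-other x (ℕ.>⇒≢ n<x) (λ { refl → ℕ.<-asym h<n n<x })) (σ-beyond x n<x))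
      ; colour-beyond = from-beyond (λ x → c x ≡ nothing) n cn≡nothing colour-beyond
      ; σ-involutive  = σ₀-involutive
      ; queue-<       = λ { x (here refl) → h<n ; x (there x∈) → ℕ.≤∧≢⇒< (ℕ.≤-pred (queue-< x x∈)) (λ { refl → n∉q x∈ }) }
      ; queue-fixed   = λ { x (here refl) → unpair-left
                          ; x (there x∈) → trans (unpair-other x (λ { refl → n∉q x∈ }) (λ { refl → h∉q x∈ })) (queue-fixed x x∈) }
      ; queue-unique  = All.tabulate (λ x∈ h≡x → h∉q (subst (_∈ q) (sym h≡x) x∈)) ∷ queue-unique
      ; arc-coloured  = arc-coloured₀
      ; queue-coloured = λ { x (here refl) → arc-coloured x (subst (h <_) (sym σh≡n) h<n) ; x (there x∈) → queue-coloured x x∈ }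
      ; uncoloured    = λ x x≮ x∉ → by-cases (λ x → c x ≡ nothing) x n (λ { refl → cn≡nothing })
                          (λ x≢n → uncoloured x (λ x< → x≮ (subst (x <_) (sym (unpair-other x x≢n (λ x≡h → x∉ (here x≡h)))) x<))
                                                (λ x∈ → x∉ (there x∈)))
      }
    σ-restored : ∀ x → pair σ₀ h n x ≡ σ x
    σ-restored x = by-cases (λ x → pair σ₀ h n x ≡ σ x) x n (λ { refl → update-same _ x h })
      (λ x≢n → trans (update-other _ n h x x≢n)
        (by-cases (λ x → update σ₀ h n x ≡ σ x) x h (λ { refl → trans (update-same σ₀ x n) (sym σh≡n) })
          (λ x≢h → trans (update-other σ₀ h n x x≢h) (unpair-other x x≢n x≢h))))

  extend-retract : ∀ n g → WellFormed (suc n) g → IsRetraction n g (retract n g)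
  extend-retract n (mkPartial σ c q) wf = by-decision (σ n ≟ n)
    where
    unmatched : ∀ mp → position n q ≡ mp → σ n ≡ n → IsRetraction n (mkPartial σ c q) (retractUnmatched n σ c q mp)
    unmatched nothing  pos≡ σn≡n = extend-retract-single n σ c q pos≡ σn≡n wf
    unmatched (just p) pos≡ σn≡n = extend-retract-opening n σ c q p pos≡ σn≡n wf
    by-decision : (d : Dec (σ n ≡ n)) → IsRetraction n (mkPartial σ c q) (retractWith n σ c q d)
    by-decision (yes σn≡n) = unmatched (position n q) refl σn≡n
    by-decision (no  σn≢n) = extend-retract-closing n σ c q σn≢n wf

  _≈ˡ_ : Letter × Partial → Letter × Partial → Set
  (l , g) ≈ˡ (l′ , g′) = l ≡ l′ × g ≈ g′

  ≈-retract : ∀ n {g g′} → g ≈ g′ → retract n g ≈ˡ retract n g′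
  ≈-retract n {mkPartial σ c q} {mkPartial σ′ c′ .q} (σ≡ , c≡ , refl) = by-decisions (σ n ≟ n) (σ′ n ≟ n)
    where
    unmatched : ∀ mp → retractUnmatched n σ c q mp ≈ˡ retractUnmatched n σ′ c′ q mp
    unmatched (just p) = cong (λ z → opening (fromMaybe default z) p) (c≡ n) , σ≡ , update-cong c≡ n nothing , refl
    unmatched nothing  = refl , σ≡ , c≡ , refl
    by-decisions : (d : Dec (σ n ≡ n)) (d′ : Dec (σ′ n ≡ n)) → retractWith n σ c q d ≈ˡ retractWith n σ′ c′ q d′
    by-decisions (yes _)    (yes _)     = unmatched (position n q)
    by-decisions (yes σn≡n) (no  σ′n≢n) = ⊥-elim (σ′n≢n (trans (sym (σ≡ n)) σn≡n))
    by-decisions (no  σn≢n) (yes σ′n≡n) = ⊥-elim (σn≢n (trans (σ≡ n) σ′n≡n))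
    by-decisions (no  _)    (no  _) rewrite σ≡ n = refl , update-cong (update-cong σ≡ n n) (σ′ n) (σ′ n) , c≡ , refl

module Automaton (r : ℕ) (default : Fin r) (j′ k′ : ℕ) where

  open import Data.Nat using (zero; suc; _≤_; z≤n; s≤s; _≤?_; _≟_; _*_)
  import Data.Nat.Properties as ℕ
  open import Data.Nat.ListAction using (sum)
  import Data.Fin as Fin
  open import Data.List using (List; []; _∷_; [_]; length; map; filter; concatMap; upTo; applyUpTo; allFin;
    cartesianProduct; cartesianProductWith; deduplicate)
  import Data.List.Properties as List
  open import Data.List.Relation.Unary.All as All using (All; []; _∷_)
  import Data.List.Relation.Unary.All.Properties as All
  open import Data.List.Relation.Unary.AllPairs using ([]; _∷_)
  open import Data.List.Relation.Unary.Any using (here; there)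
  open import Data.List.Membership.Propositional using (_∈_; find; lose)
  open import Data.List.Membership.Propositional.Properties
    using (∈-map⁺; ∈-allFin; ∈-upTo⁺; ∈-upTo⁻; ∈-cartesianProduct⁺; ∈-cartesianProductWith⁺; ∈-cartesianProductWith⁻; ∈-deduplicate⁺;
           ∈-concatMap⁺; ∈-concatMap⁻; ∈-filter⁺; ∈-filter⁻)
  open import Data.List.Relation.Unary.Unique.Propositional using (Unique)
  import Data.List.Relation.Unary.Unique.Propositional.Properties as Unique
  open import Data.List.Relation.Unary.Unique.DecPropositional.Properties using (deduplicate-!)
  open import Data.Maybe using (Maybe; just; nothing; _>>=_)
  import Data.Maybe.Properties as Maybe
  import Data.Product.Properties as Product
  open import Data.Product using (Σ; _×_; _,_; proj₁; proj₂)
  open import Data.Sum using (inj₁; inj₂)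
  open import Data.Unit using (tt)
  open import Data.Empty using (⊥; ⊥-elim)
  open import Function using (_∘_)
  open import Relation.Binary.PropositionalEquality using (_≡_; refl; sym; trans; cong; cong₂; subst)
  open import Relation.Binary.Definitions using (DecidableEquality)
  open import Relation.Nullary using (¬_; Dec; yes; no)

  open Chains
  open ListOps
  open RationalSeries using (rational-of-linear-recurrence; rational-congˡ)
  open Generation r
  open Retraction r default

  bound : Kind → ℕ
  bound crossing = j′
  bound nesting  = k′

  Admissible : Abstract → Set
  Admissible s = ∀ k → ¬ Chain (AbstractPattern k) nothing (suc (bound k)) s

  admissible? : ∀ s → Dec (Admissible s)
  admissible? s with chain? (abstractPattern? crossing) nothing (suc j′) s | chain? (abstractPattern? nesting) nothing (suc k′) s
  ... | no ¬cr | no ¬ne = yes λ { crossing → ¬cr ; nesting → ¬ne }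
  ... | yes cr | _      = no λ adm → adm crossing cr
  ... | _      | yes ne = no λ adm → adm nesting ne

  NoPatterns : ℕ → Partial → Set
  NoPatterns n g = ∀ k → ¬ HasPattern k n g (bound k)

  admit : Abstract → Maybe Abstract
  admit s with admissible? s
  ... | yes _ = just s
  ... | no  _ = nothing

  admit-just : ∀ {s s′} → admit s ≡ just s′ → Admissible s × s ≡ s′
  admit-just {s} eq with admissible? s
  admit-just refl | yes adm = adm , refl

  admit-admissible : ∀ s → Admissible s → admit s ≡ just s
  admit-admissible s adm with admissible? s
  ... | yes _    = refl
  ... | no ¬adm = ⊥-elim (¬adm adm)

  step : Letter → Abstract → Maybe Abstract
  step l s = abstractStep l s >>= admit

  run : List Letter → Maybe Abstract
  run []      = just []
  run (l ∷ w) = run w >>= step l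

  >>=-just : {A B : Set} (m : Maybe A) (f : A → Maybe B) {b : B} → (m >>= f) ≡ just b → Σ A λ a → m ≡ just a × f a ≡ just b
  >>=-just (just a) f eq = a , refl , eq

  abstractStep-applicable : ∀ g l {s} → abstractStep l (abstraction g) ≡ just s → Applicable l (queue g)
  abstractStep-applicable g single        eq = tt
  abstractStep-applicable g (opening a p) eq with p ≤? length (abstraction g)
  ... | yes p≤ = subst (p ≤_) (List.length-map _ (queue g)) p≤
  abstractStep-applicable (mkPartial _ _ [])      closing ()
  abstractStep-applicable (mkPartial _ _ (_ ∷ _)) closing eq = tt

  noPatterns-extend : ∀ n g l → WellFormed n g → Applicable l (queue g) → NoPatterns n g →
    Admissible (abstraction (extend n l g)) → NoPatterns (suc n) (extend n l g)
  noPatterns-extend n g l wf app none adm k pat with HasPattern-extend⁻ k n g l (bound k) wf app pat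
  ... | inj₁ old = none k old
  ... | inj₂ ch  = adm k (abstraction-pattern⁺ k (extend n l g) (suc (bound k)) ch)

  wellFormed-empty : WellFormed 0 (build [])
  wellFormed-empty = record
    { σ-beyond = λ _ _ → refl ; colour-beyond = λ _ _ → refl ; σ-involutive = λ _ → refl
    ; queue-< = λ _ () ; queue-fixed = λ _ () ; queue-unique = []
    ; arc-coloured = λ x x< → ⊥-elim (ℕ.<-irrefl refl x<) ; queue-coloured = λ _ () ; uncoloured = λ _ _ _ → refl }

  noPatterns-empty : NoPatterns 0 (build [])
  noPatterns-empty k (zero , _ , ())

  run-sound : ∀ w s → run w ≡ just s →
    WellFormed (length w) (build w) × NoPatterns (length w) (build w) × abstraction (build w) ≡ s
  run-sound []      .[] refl = wellFormed-empty , noPatterns-empty , refl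
  run-sound (l ∷ w) s eq with >>=-just (run w) (step l) eq
  ... | s₀ , run≡ , step≡ with >>=-just (abstractStep l s₀) admit step≡
  ...   | s₁ , abstract≡ , admit≡ with admit-just admit≡ | run-sound w s₀ run≡
  ...     | adm , refl | wf , none , refl =
    extend-wellFormed n g l wf app , noPatterns-extend n g l wf app none (subst Admissible (sym abstraction≡) adm) , abstraction≡
    where
    n = length w
    g = build w
    app = abstractStep-applicable g l abstract≡
    abstraction≡ : abstraction (extend n l g) ≡ s₁
    abstraction≡ = Maybe.just-injective (trans (sym (abstractStep-extend n g l wf app)) abstract≡)

  build-empty : ∀ g → WellFormed 0 g → queue g ≡ []
  build-empty (mkPartial _ _ [])      wf = refl
  build-empty (mkPartial _ _ (x ∷ _)) wf with () ← WellFormed.queue-< wf x (here refl)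

  run-complete : ∀ n g → WellFormed n g → NoPatterns n g →
    Σ (List Letter) λ w → length w ≡ n × run w ≡ just (abstraction g) × build w ≈ g
  run-complete zero g wf _ = [] , refl , cong just (sym (cong (map _) (build-empty g wf))) ,
    (λ x → sym (WellFormed.σ-beyond wf x z≤n)) , (λ x → sym (WellFormed.colour-beyond wf x z≤n)) , sym (build-empty g wf)
  run-complete (suc n) g wf none = l ∷ w₀ , cong suc length≡ , run≡ , build≈
    where
    l = proj₁ (retract n g)
    g₀ = proj₂ (retract n g)
    retraction = extend-retract n g wf
    wf₀ = proj₁ retraction
    app = proj₁ (proj₂ retraction)
    extend≈ = proj₂ (proj₂ retraction)
    none₀ : NoPatterns n g₀
    none₀ k pat = none k (≈-HasPattern k (suc n) (bound k) extend≈ (HasPattern-extend⁺ k n g₀ l (bound k) wf₀ app pat))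
    IH = run-complete n g₀ wf₀ none₀
    w₀ = proj₁ IH
    length≡ = proj₁ (proj₂ IH)
    build≈₀ = proj₂ (proj₂ (proj₂ IH))
    adm : Admissible (abstraction (extend n l g₀))
    adm k ch = none k (≈-HasPattern k (suc n) (bound k) extend≈
      (HasPattern-now k (suc n) (extend n l g₀) (bound k) (extend-wellFormed n g₀ l wf₀ app)
        (abstraction-pattern⁻ k (extend n l g₀) (suc (bound k)) ch)))
    run≡ : run (l ∷ w₀) ≡ just (abstraction g)
    run≡ = trans (cong (_>>= step l) (proj₁ (proj₂ (proj₂ IH))))
           (trans (cong (_>>= admit) (abstractStep-extend n g₀ l wf₀ app))
           (trans (admit-admissible _ adm) (cong just (≈-abstraction extend≈))))
    build≈ : build (l ∷ w₀) ≈ g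
    build≈ = subst (λ m → extend m l (build w₀) ≈ g) (sym length≡) (≈-trans (≈-extend n l build≈₀) extend≈)

  extend-injective : ∀ n g g′ l l′ → WellFormed n g → Applicable l (queue g) → WellFormed n g′ → Applicable l′ (queue g′) →
    extend n l g ≈ extend n l′ g′ → l ≡ l′ × g ≈ g′
  extend-injective n g g′ l l′ wf app wf′ app′ ext≈ =
    trans (sym (proj₁ retract₁)) (trans (proj₁ retract≈) (proj₁ retract₂)) ,
    ≈-trans (≈-sym (proj₂ retract₁)) (≈-trans (proj₂ retract≈) (proj₂ retract₂))
    where
    retract₁ = retract-extend n g l wf app
    retract₂ = retract-extend n g′ l′ wf′ app′
    retract≈ = ≈-retract n ext≈

  run-applicable : ∀ l w s → run (l ∷ w) ≡ just s → Σ Abstract λ s₀ → run w ≡ just s₀ × Applicable l (queue (build w))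
  run-applicable l w s eq with >>=-just (run w) (step l) eq
  ... | s₀ , run≡ , step≡ with >>=-just (abstractStep l s₀) admit step≡
  ...   | s₁ , abstract≡ , _ = s₀ , run≡ ,
    abstractStep-applicable (build w) l (trans (cong (abstractStep l) (proj₂ (proj₂ (run-sound w s₀ run≡)))) abstract≡)

  build-injective : ∀ w w′ s s′ → run w ≡ just s → run w′ ≡ just s′ → length w ≡ length w′ → build w ≈ build w′ → w ≡ w′
  build-injective []      []        _ _ _ _ _ _ = refl
  build-injective (l ∷ w) (l′ ∷ w′) s s′ run≡ run≡′ length≡ build≈ =
    cong₂ _∷_ (proj₁ extend≡) (build-injective w w′ _ _ (proj₁ (proj₂ app)) (proj₁ (proj₂ app′)) length≡′ (proj₂ extend≡))
    where
    length≡′ = ℕ.suc-injective length≡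
    app = run-applicable l w s run≡
    app′ = run-applicable l′ w′ s′ run≡′
    wf = proj₁ (run-sound w _ (proj₁ (proj₂ app)))
    wf′ = subst (λ m → WellFormed m (build w′)) (sym length≡′) (proj₁ (run-sound w′ _ (proj₁ (proj₂ app′))))
    extend≡ = extend-injective (length w) (build w) (build w′) l l′ wf (proj₂ (proj₂ app)) wf′ (proj₂ (proj₂ app′))
      (subst (λ m → extend (length w) l (build w) ≈ extend m l′ (build w′)) (sym length≡′) build≈)

  -- Finitely many states and letters

  colours : List (Maybe (Fin r))
  colours = nothing ∷ map just (allFin r)

  ∈-colours : ∀ c → c ∈ colours
  ∈-colours nothing  = here refl
  ∈-colours (just a) = there (∈-map⁺ just (∈-allFin a))

  maxLength : ℕ
  maxLength = length colours * esBound (suc j′) (suc k′)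

  queue-bounded : ∀ n g → WellFormed n g → NoPatterns n g → length (queue g) ≤ maxLength
  queue-bounded n g wf none = colored-erdős-szekeres (Maybe.≡-dec Fin._≟_) (colour g) colours (suc j′) (suc k′) (queue g)
    (WellFormed.queue-unique wf) (All.tabulate (λ _ → ∈-colours _))
    (none crossing ∘ HasPattern-now crossing n g j′ wf) (none nesting ∘ HasPattern-now nesting n g k′ wf)

  _≟ₐ_ : DecidableEquality Abstract
  _≟ₐ_ = List.≡-dec (Product.≡-dec (Maybe.≡-dec Fin._≟_) _≟_)

  states : List Abstract
  states = deduplicate _≟ₐ_ (listsOver (cartesianProduct colours (upTo maxLength)) maxLength)

  reachable-state : ∀ w s → run w ≡ just s → s ∈ states
  reachable-state w s run≡ with run-sound w s run≡
  ... | wf , none , refl = ∈-deduplicate⁺ _≟ₐ_ (∈-listsOver _ maxLength (abstraction g) length≤ (All.map⁺ (All.tabulate entry∈)))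
    where
    g = build w
    bounded = queue-bounded (length w) g wf none
    length≤ : length (abstraction g) ≤ maxLength
    length≤ = subst (_≤ maxLength) (sym (List.length-map _ (queue g))) bounded
    entry∈ : ∀ {x} → x ∈ queue g → (colour g x , rank x (queue g)) ∈ cartesianProduct colours (upTo maxLength)
    entry∈ {x} x∈ = ∈-cartesianProduct⁺ (∈-colours _) (∈-upTo⁺ (ℕ.<-≤-trans (rank-< x (queue g) x∈) bounded))

  openings : List Letter
  openings = cartesianProductWith opening (allFin r) (upTo (suc maxLength))

  letters : List Letter
  letters = single ∷ closing ∷ openings

  letters-unique : Unique letters
  letters-unique = ((λ ()) ∷ All.tabulate single≢opening)
                 ∷ All.tabulate closing≢opening
                 ∷ Unique.cartesianProductWith⁺ opening (λ { refl → refl , refl }) (Unique.allFin⁺ r) (Unique.upTo⁺ (suc maxLength))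
    where
    single≢opening : ∀ {l} → l ∈ openings → single ≡ l → ⊥
    single≢opening l∈ eq with ∈-cartesianProductWith⁻ opening (allFin r) (upTo (suc maxLength)) l∈
    single≢opening l∈ () | _ , _ , _ , _ , refl
    closing≢opening : ∀ {l} → l ∈ openings → closing ≡ l → ⊥
    closing≢opening l∈ eq with ∈-cartesianProductWith⁻ opening (allFin r) (upTo (suc maxLength)) l∈
    closing≢opening l∈ () | _ , _ , _ , _ , refl

  step-letter : ∀ w t l s → run w ≡ just t → abstractStep l t ≡ just s → l ∈ letters
  step-letter w t single        s _     _ = here refl
  step-letter w t closing       s _     _ = there (here refl)
  step-letter w t (opening a p) s run≡ eq with p ≤? length t
  ... | yes p≤ = there (there (∈-cartesianProductWith⁺ opening (∈-allFin a) (∈-upTo⁺ (s≤s (ℕ.≤-trans p≤ length≤)))))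
    where
    length≤ : length t ≤ maxLength
    length≤ with run-sound w t run≡
    ... | wf , none , refl = subst (_≤ maxLength) (sym (List.length-map _ (queue (build w)))) (queue-bounded _ _ wf none)

  -- Counting accepted words: a linear recurrence

  stateCount : ℕ
  stateCount = length states

  -- Out-of-range indices give the junk state [].
  stateAt : ℕ → Abstract
  stateAt = nth [] states

  _≟ₘ_ : DecidableEquality (Maybe Abstract)
  _≟ₘ_ = Maybe.≡-dec _≟ₐ_

  lettersTo : Abstract → Abstract → List Letter
  lettersTo s t = filter (λ l → step l t ≟ₘ just s) letters

  wordsTo : Abstract → ℕ → List (List Letter)
  wordsTo s zero with s ≟ₐ []
  ... | yes _ = [ [] ]
  ... | no  _ = []
  wordsTo s (suc n) = concatMap (λ k → prefixAll (lettersTo s (stateAt k)) (wordsTo (stateAt k) n)) (upTo stateCount)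

  ∈-wordsTo⁻ : ∀ n s w → w ∈ wordsTo s n → length w ≡ n × run w ≡ just s
  ∈-wordsTo⁻ zero s w w∈ with s ≟ₐ []
  ∈-wordsTo⁻ zero s .[] (here refl) | yes refl = refl , refl
  ∈-wordsTo⁻ (suc n) s w w∈ with find (∈-concatMap⁻ (λ k → prefixAll (lettersTo s (stateAt k)) (wordsTo (stateAt k) n)) {xs = upTo stateCount} w∈)
  ... | k , _ , w∈′ with ∈-prefixAll⁻ (lettersTo s (stateAt k)) (wordsTo (stateAt k) n) w∈′
  ...   | l , w₀ , l∈ , w₀∈ , refl with ∈-wordsTo⁻ n (stateAt k) w₀ w₀∈
  ...     | length≡ , run≡ = cong suc length≡ , trans (cong (_>>= step l) run≡) (proj₂ (∈-filter⁻ (λ l → step l (stateAt k) ≟ₘ just s) {xs = letters} l∈))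

  ∈-wordsTo⁺ : ∀ n s w → length w ≡ n → run w ≡ just s → w ∈ wordsTo s n
  ∈-wordsTo⁺ zero s [] _ run≡ with s ≟ₐ []
  ... | yes _   = here refl
  ... | no  s≢[] = ⊥-elim (s≢[] (sym (Maybe.just-injective run≡)))
  ∈-wordsTo⁺ (suc n) s (l ∷ w₀) length≡ run≡ with >>=-just (run w₀) (step l) run≡
  ... | t , run≡₀ , step≡ with ∈-nth [] states (reachable-state w₀ t run≡₀)
  ...   | k , k< , refl with >>=-just (abstractStep l (stateAt k)) admit step≡
  ...     | _ , abstract≡ , _ =
    ∈-concatMap⁺ (λ k → prefixAll (lettersTo s (stateAt k)) (wordsTo (stateAt k) n))
      (lose (∈-upTo⁺ k<) (∈-prefixAll⁺ (lettersTo s (stateAt k)) (wordsTo (stateAt k) n)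
        (∈-filter⁺ (λ l → step l (stateAt k) ≟ₘ just s) (step-letter w₀ (stateAt k) l _ run≡₀ abstract≡) step≡)
        (∈-wordsTo⁺ n (stateAt k) w₀ (ℕ.suc-injective length≡) run≡₀)))

  wordsTo-unique : ∀ n s → Unique (wordsTo s n)
  wordsTo-unique zero s with s ≟ₐ []
  ... | yes _ = [] ∷ []
  ... | no  _ = []
  wordsTo-unique (suc n) s = concatMap-unique F (upTo stateCount) (Unique.upTo⁺ stateCount)
    (λ k _ → prefixAll-unique (lettersTo s (stateAt k)) (wordsTo (stateAt k) n)
               (Unique.filter⁺ (λ l → step l (stateAt k) ≟ₘ just s) letters-unique) (wordsTo-unique n (stateAt k)))
    (λ k k′ w k∈ k′∈ w∈ w∈′ → nth-injective [] states k k′ (deduplicate-! _≟ₐ_ (listsOver (cartesianProduct colours (upTo maxLength)) maxLength)) (∈-upTo⁻ k∈) (∈-upTo⁻ k′∈)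
       (Maybe.just-injective (trans (sym (ends k w w∈)) (ends k′ w w∈′))))
    where
    F : ℕ → List (List Letter)
    F k = prefixAll (lettersTo s (stateAt k)) (wordsTo (stateAt k) n)
    ends : ∀ k w → w ∈ F k → run (Data.List.drop 1 w) ≡ just (stateAt k)
    ends k w w∈ with ∈-prefixAll⁻ (lettersTo s (stateAt k)) (wordsTo (stateAt k) n) w∈
    ... | _ , w₀ , _ , w₀∈ , refl = proj₂ (∈-wordsTo⁻ n (stateAt k) w₀ w₀∈)

  transitions : Abstract → Abstract → ℕ
  transitions s t = length (lettersTo s t)

  length-wordsTo : ∀ n s → length (wordsTo s (suc n)) ≡ sum (applyUpTo (λ k → transitions s (stateAt k) * length (wordsTo (stateAt k) n)) stateCount)
  length-wordsTo n s = trans (length-concatMap F (upTo stateCount))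
    (trans (cong sum (List.map-cong (λ k → length-prefixAll (lettersTo s (stateAt k)) (wordsTo (stateAt k) n)) (upTo stateCount)))
           (cong sum (List.map-applyUpTo (λ k → k) _ stateCount)))
    where
    F : ℕ → List (List Letter)
    F k = prefixAll (lettersTo s (stateAt k)) (wordsTo (stateAt k) n)

  accepted-count : ∀ n → IsCount (λ w → length w ≡ n × run w ≡ just []) (length (wordsTo [] n))
  accepted-count n = wordsTo [] n , wordsTo-unique n [] , (λ w → ∈-wordsTo⁻ n [] w) ,
    (λ w (length≡ , run≡) → ∈-wordsTo⁺ n [] w length≡ run≡) , refl

  accepted-rational : IsRationalSeries (λ n → length (wordsTo [] n))
  accepted-rational with ∈-nth [] states (reachable-state [] [] refl)
  ... | i₀ , i₀< , stateAt-i₀ = rational-congˡ (λ n → cong (λ s → length (wordsTo s n)) (sym stateAt-i₀))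
    (rational-of-linear-recurrence stateCount (λ i k → transitions (stateAt i) (stateAt k)) (λ i n → length (wordsTo (stateAt i) n))
      (λ i n _ → length-wordsTo n (stateAt i)) i₀ i₀<)

module MatchingLink (r : ℕ) where

  open import Data.Nat using (zero; suc; _<_; _≤_; z≤n; s≤s; _<?_; _∸_)
  import Data.Nat.Properties as ℕ
  open import Data.Fin using (Fin; toℕ; fromℕ; fromℕ<; opposite) renaming (zero to fzero)
  import Data.Fin.Properties as Fin
  open import Data.Vec using (lookup)
  open import Data.List using (List; []; length; map; filter; tabulate)
  import Data.List.Properties as List
  open import Data.List.Relation.Unary.AllPairs using (AllPairs; [])
  import Data.List.Relation.Unary.AllPairs.Properties as AllPairs
  open import Data.List.Membership.Propositional using (_∈_)
  open import Data.List.Membership.Propositional.Properties using (∈-filter⁺; ∈-filter⁻; ∈-tabulate⁻)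
  open import Data.List.Relation.Binary.Sublist.Propositional using (_⊆_)
  open import Data.List.Relation.Binary.Sublist.Propositional.Properties as Sublist using (Any-resp-⊆)
  open import Data.Maybe using (Maybe; just; nothing)
  open import Data.Product using (Σ; _×_; _,_; proj₁; proj₂)
  open import Data.Sum using (inj₁; inj₂)
  open import Data.Empty using (⊥-elim)
  open import Function using (_∘_)
  open import Relation.Binary.PropositionalEquality using (_≡_; refl; sym; trans; cong; subst; subst₂)
  open import Relation.Nullary using (¬_; yes; no)
  open import Relation.Nullary.Decidable using (dec-yes; dec-no)

  open Chains
  open ListOps
  open Generation r

  Pattern-trans : ∀ k {c : ℕ → Maybe (Fin r)} {x y z} → Pattern k c x y → Pattern k c y z → Pattern k c x z
  Pattern-trans crossing (c≡ , x<y) (c≡′ , y<z) = trans c≡ c≡′ , ℕ.<-trans x<y y<z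
  Pattern-trans nesting  (c≡ , x>y) (c≡′ , y>z) = trans c≡ c≡′ , ℕ.<-trans y>z x>y

  strict⇒≤ : ∀ {k} (g : Fin k → ℕ) → (∀ a b → a <ᶠ b → g a < g b) → ∀ a b → toℕ a ≤ toℕ b → g a ≤ g b
  strict⇒≤ g g-inc a b a≤b with ℕ.m≤n⇒m<n∨m≡n a≤b
  ... | inj₁ a<b = ℕ.<⇒≤ (g-inc a b a<b)
  ... | inj₂ a≡b = ℕ.≤-reflexive (cong g (Fin.toℕ-injective a≡b))

  ≤-fromℕ : ∀ {m} (a : Fin (suc m)) → toℕ a ≤ toℕ (fromℕ m)
  ≤-fromℕ {m} a = subst (toℕ a ≤_) (sym (Fin.toℕ-fromℕ m)) (Fin.toℕ≤pred[n] a)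

  opposite-< : ∀ {m} (a b : Fin (suc m)) → a <ᶠ b → opposite b <ᶠ opposite a
  opposite-< {m} a b a<b rewrite Fin.opposite-prop a | Fin.opposite-prop b = ℕ.∸-monoʳ-< a<b (ℕ.≤-pred (Fin.toℕ<n b))

  module Encoding {n : ℕ} (M : ColoredMatchingData n r) where

    σM : ℕ → ℕ
    σM x with x <? n
    ... | yes x<n = toℕ (lookup (proj₁ M) (fromℕ< x<n))
    ... | no  _   = x

    colourM : ℕ → Maybe (Fin r)
    colourM x with x <? n
    ... | yes x<n = lookup (proj₂ M) (fromℕ< x<n)
    ... | no  _   = nothing

    encode : Partial
    encode = mkPartial σM colourM []

    σM-fin : ∀ i → σM (toℕ i) ≡ toℕ (lookup (proj₁ M) i)
    σM-fin i rewrite dec-yes (toℕ i <? n) (Fin.toℕ<n i) .proj₂ = cong (toℕ ∘ lookup (proj₁ M)) (Fin.fromℕ<-toℕ i _)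

    colourM-fin : ∀ i → colourM (toℕ i) ≡ lookup (proj₂ M) i
    colourM-fin i rewrite dec-yes (toℕ i <? n) (Fin.toℕ<n i) .proj₂ = cong (lookup (proj₂ M)) (Fin.fromℕ<-toℕ i _)

    σM-beyond : ∀ x → n ≤ x → σM x ≡ x
    σM-beyond x n≤x rewrite dec-no (x <? n) (ℕ.≤⇒≯ n≤x) = refl

    colourM-beyond : ∀ x → n ≤ x → colourM x ≡ nothing
    colourM-beyond x n≤x rewrite dec-no (x <? n) (ℕ.≤⇒≯ n≤x) = refl

    fin-or-beyond : (P : ℕ → Set) → (∀ i → P (toℕ i)) → (∀ x → n ≤ x → P x) → ∀ x → P x
    fin-or-beyond P P-fin P-beyond x with x <? n
    ... | yes x<n = subst P (Fin.toℕ-fromℕ< x<n) (P-fin (fromℕ< x<n))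
    ... | no  x≮n = P-beyond x (ℕ.≮⇒≥ x≮n)

    encode-wellFormed : IsColoredMatching M → WellFormed n encode
    encode-wellFormed (involutive , arc-coloured , uncoloured) = record
      { σ-beyond      = σM-beyond
      ; colour-beyond = colourM-beyond
      ; σ-involutive  = fin-or-beyond (λ x → σM (σM x) ≡ x)
          (λ i → trans (cong σM (σM-fin i)) (trans (σM-fin (lookup (proj₁ M) i)) (cong toℕ (involutive i))))
          (λ x n≤x → trans (cong σM (σM-beyond x n≤x)) (σM-beyond x n≤x))
      ; queue-<       = λ _ ()
      ; queue-fixed   = λ _ ()
      ; queue-unique  = []
      ; arc-coloured  = fin-or-beyond (λ x → x < σM x → Σ (Fin r) λ a → colourM x ≡ just a)
          (λ i i< → let a , eq = arc-coloured i (subst (toℕ i <_) (σM-fin i) i<) in a , trans (colourM-fin i) eq)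
          (λ x n≤x x< → ⊥-elim (ℕ.<-irrefl (sym (σM-beyond x n≤x)) x<))
      ; queue-coloured = λ _ ()
      ; uncoloured    = fin-or-beyond (λ x → ¬ x < σM x → ¬ x ∈ [] → colourM x ≡ nothing)
          (λ i i≮ _ → trans (colourM-fin i) (uncoloured i (λ i< → i≮ (subst (toℕ i <_) (sym (σM-fin i)) i<))))
          (λ x n≤x _ _ → colourM-beyond x n≤x)
      }

    isColoredMatching : WellFormed n encode → IsColoredMatching M
    isColoredMatching wf =
      (λ i → Fin.toℕ-injective (trans (sym (σM-fin (lookup (proj₁ M) i))) (trans (cong σM (sym (σM-fin i))) (σ-involutive (toℕ i))))) ,
      (λ i i< → let a , eq = arc-coloured (toℕ i) (subst (toℕ i <_) (sym (σM-fin i)) i<) in a , trans (sym (colourM-fin i)) eq) ,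
      (λ i i≮ → trans (sym (colourM-fin i)) (uncoloured (toℕ i) (λ i< → i≮ (subst (toℕ i <_) (σM-fin i) i<)) (λ ())))
      where open WellFormed wf

    module Patterns (isM : IsColoredMatching M) where

      wf : WellFormed n encode
      wf = encode-wellFormed isM

      partner : Fin n → Fin n
      partner = lookup (proj₁ M)

      σM-σ : ∀ i → σM (toℕ (partner i)) ≡ toℕ i
      σM-σ i = trans (σM-fin (partner i)) (cong toℕ (proj₁ isM i))

      window : ℕ → List ℕ
      window t = filter (λ y → σM y <? t) (interval t (n ∸ t))

      openAcross-encode : ∀ t → openAcross n t encode ≡ map σM (window t)
      openAcross-encode t = List.++-identityʳ _

      pattern-of-closers : ∀ k m t → t ≤ n → (z : Fin (suc m) → ℕ) → (∀ a b → a <ᶠ b → z a < z b) →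
        (∀ a → t ≤ z a × z a < n × σM (z a) < t) → (∀ a b → a <ᶠ b → Pattern k colourM (σM (z a)) (σM (z b))) →
        HasPattern k n encode m
      pattern-of-closers k m t t≤n z z-inc z-window z-pattern = t , t≤n ,
        subst (Chain (Pattern k colourM) nothing (suc m)) (sym (openAcross-encode t))
          (Chain-⊆ (Sublist.map⁺ σM closers⊆)
            (subst (λ l → Chain (Pattern k colourM) nothing l (map σM (tabulate z))) length≡
              (AllPairs⇒Chain _ (AllPairs.map⁺ (AllPairs.tabulate⁺-< (λ {a} {b} → z-pattern a b))))))
        where
        closer∈ : ∀ {y} → y ∈ tabulate z → y ∈ window t
        closer∈ y∈ with ∈-tabulate⁻ {f = z} y∈
        ... | a , refl = let t≤z , z<n , σz<t = z-window a in
          ∈-filter⁺ (λ y → σM y <? t) (∈-interval⁺ t (n ∸ t) t≤z (subst (z a <_) (sym (ℕ.m+[n∸m]≡n t≤n)) z<n)) σz<t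
        closers⊆ : tabulate z ⊆ window t
        closers⊆ = increasing-⊆ (tabulate z) (window t) (AllPairs.tabulate⁺-< (λ {a} {b} → z-inc a b))
          (AllPairs.filter⁺ (λ y → σM y <? t) (interval-increasing t (n ∸ t)))
          closer∈
        length≡ : length (map σM (tabulate z)) ≡ suc m
        length≡ = trans (List.length-map σM (tabulate z)) (List.length-tabulate z)

      crossing⇒pattern : ∀ m → MonoCrossing M m → HasPattern crossing n encode m
      crossing⇒pattern m (f , col , f-col , f-inc , last<σfirst , σf-inc) =
        pattern-of-closers crossing m (suc (toℕ (f (fromℕ m)))) (Fin.toℕ<n (f (fromℕ m))) (toℕ ∘ partner ∘ f) σf-inc
          (λ a → ℕ.<-≤-trans last<σfirst (strict⇒≤ (toℕ ∘ partner ∘ f) σf-inc fzero a z≤n) , Fin.toℕ<n _ ,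
                 s≤s (subst (_≤ toℕ (f (fromℕ m))) (sym (σM-σ (f a))) (strict⇒≤ (toℕ ∘ f) f-inc a (fromℕ m) (≤-fromℕ a))))
          (λ a b a<b → subst₂ (Pattern crossing colourM) (sym (σM-σ (f a))) (sym (σM-σ (f b)))
            (trans (colourM-fin (f a)) (trans (f-col a) (sym (trans (colourM-fin (f b)) (f-col b)))) , f-inc a b a<b))

      nesting⇒pattern : ∀ m → MonoNesting M m → HasPattern nesting n encode m
      nesting⇒pattern m (f , col , f-col , f-inc , last<σlast , σf-dec) =
        pattern-of-closers nesting m (suc (toℕ (f (fromℕ m)))) (Fin.toℕ<n (f (fromℕ m))) (toℕ ∘ partner ∘ f ∘ opposite)
          (λ a b a<b → σf-dec (opposite b) (opposite a) (opposite-< a b a<b))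
          (λ a → ℕ.<-≤-trans last<σlast (σ-last≤ (opposite a)) , Fin.toℕ<n _ ,
                 s≤s (subst (_≤ toℕ (f (fromℕ m))) (sym (σM-σ (f (opposite a))))
                            (strict⇒≤ (toℕ ∘ f) f-inc (opposite a) (fromℕ m) (≤-fromℕ (opposite a)))))
          (λ a b a<b → subst₂ (Pattern nesting colourM) (sym (σM-σ (f (opposite a)))) (sym (σM-σ (f (opposite b))))
            (trans (colourM-fin (f (opposite a))) (trans (f-col _) (sym (trans (colourM-fin (f (opposite b))) (f-col _)))) ,
             f-inc (opposite b) (opposite a) (opposite-< a b a<b)))
        where
        σ-last≤ : ∀ a → toℕ (partner (f (fromℕ m))) ≤ toℕ (partner (f a))
        σ-last≤ a with ℕ.m≤n⇒m<n∨m≡n (≤-fromℕ a)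
        ... | inj₁ a<last = ℕ.<⇒≤ (σf-dec a (fromℕ m) a<last)
        ... | inj₂ a≡last = ℕ.≤-reflexive (cong (toℕ ∘ partner ∘ f) (Fin.toℕ-injective (sym a≡last)))

      record Closers (k : Kind) (m : ℕ) : Set where
        field
          t          : ℕ
          t≤n        : t ≤ n
          z          : ℕ → ℕ
          in-window  : ∀ i → i < suc m → t ≤ z i × z i < n × σM (z i) < t
          increasing : ∀ i j → i < j → j < suc m → z i < z j
          related    : ∀ i j → i < j → j < suc m → Pattern k colourM (σM (z i)) (σM (z j))

      closers : ∀ k m → HasPattern k n encode m → Closers k m
      closers k m (t , t≤n , ch) = record
        { t = t ; t≤n = t≤n ; z = nth 0 zs
        ; in-window = in-window
        ; increasing = λ i j i<j j≤m → AllPairs-nth 0 zs i j zs-increasing i<j (bounded j j≤m)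
        ; related = λ i j i<j j≤m → AllPairs-nth 0 zs i j zs-pattern i<j (bounded j j≤m)
        }
        where
        chosen = Chain⇒AllPairs (Pattern-trans k) ch
        ys = proj₁ chosen
        ys⊆ : ys ⊆ map σM (window t)
        ys⊆ = subst (ys ⊆_) (openAcross-encode t) (proj₁ (proj₂ chosen))
        pulled = ⊆-map⁻ σM (window t) ys⊆
        zs = proj₁ pulled
        zs⊆ = proj₁ (proj₂ pulled)
        map≡ = proj₂ (proj₂ pulled)
        zs-increasing : AllPairs _<_ zs
        zs-increasing = AllPairs-⊆ zs⊆ (AllPairs.filter⁺ (λ y → σM y <? t) (interval-increasing t (n ∸ t)))
        zs-pattern : AllPairs (λ x y → Pattern k colourM (σM x) (σM y)) zs
        zs-pattern = AllPairs.map⁻ (subst (AllPairs (Pattern k colourM)) (sym map≡) (proj₁ (proj₂ (proj₂ (proj₂ chosen)))))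
        length≡ : length zs ≡ suc m
        length≡ = trans (sym (List.length-map σM zs)) (trans (cong length map≡) (proj₁ (proj₂ (proj₂ chosen))))
        bounded : ∀ i → i < suc m → i < length zs
        bounded i i≤m = subst (i <_) (sym length≡) i≤m
        in-window : ∀ i → i < suc m → t ≤ nth 0 zs i × nth 0 zs i < n × σM (nth 0 zs i) < t
        in-window i i≤m =
          let z∈ , σz<t = ∈-filter⁻ (λ y → σM y <? t) {xs = interval t (n ∸ t)} (Any-resp-⊆ zs⊆ (nth-∈ 0 zs i (bounded i i≤m)))
              t≤z , z< = ∈-interval⁻ t (n ∸ t) z∈
          in t≤z , subst (nth 0 zs i <_) (ℕ.m+[n∸m]≡n t≤n) z< , σz<t

      module Openers {k m} (C : Closers k m) where
        open Closers C

        opener : ∀ i → i < suc m → Fin n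
        opener i i≤m = fromℕ< (ℕ.<-≤-trans (proj₂ (proj₂ (in-window i i≤m))) t≤n)

        opener-toℕ : ∀ i i≤m → toℕ (opener i i≤m) ≡ σM (z i)
        opener-toℕ i i≤m = Fin.toℕ-fromℕ< _

        partner-opener : ∀ i i≤m → toℕ (partner (opener i i≤m)) ≡ z i
        partner-opener i i≤m = trans (sym (σM-fin (opener i i≤m))) (trans (cong σM (opener-toℕ i i≤m)) (WellFormed.σ-involutive wf (z i)))

        opener-< : ∀ i i≤m → toℕ (opener i i≤m) < toℕ (partner (opener i i≤m))
        opener-< i i≤m = subst₂ _<_ (sym (opener-toℕ i i≤m)) (sym (partner-opener i i≤m))
          (ℕ.<-≤-trans (proj₂ (proj₂ (in-window i i≤m))) (proj₁ (in-window i i≤m)))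

        first-coloured : Σ (Fin r) λ a → colourM (σM (z 0)) ≡ just a
        first-coloured = WellFormed.arc-coloured wf (σM (z 0))
          (subst (σM (z 0) <_) (sym (WellFormed.σ-involutive wf (z 0))) (ℕ.<-≤-trans (proj₂ (proj₂ w₀)) (proj₁ w₀)))
          where w₀ = in-window 0 (s≤s z≤n)

        colour₀ : Fin r
        colour₀ = proj₁ first-coloured

        opener-colour : ∀ i i≤m → lookup (proj₂ M) (opener i i≤m) ≡ just colour₀
        opener-colour i i≤m = trans (sym (colourM-fin (opener i i≤m))) (trans (cong colourM (opener-toℕ i i≤m))
          (trans (sym (same-colour i i≤m)) (proj₂ first-coloured)))
          where
          same-colour : ∀ i → i < suc m → colourM (σM (z 0)) ≡ colourM (σM (z i))
          same-colour zero    _   = refl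
          same-colour (suc i) i≤m = proj₁ (related 0 (suc i) (s≤s z≤n) i≤m)

        opener-pattern : ∀ i j (i<j : i < j) (j≤m : j < suc m) → order k (toℕ (opener i (ℕ.<-trans i<j j≤m))) (toℕ (opener j j≤m))
        opener-pattern i j i<j j≤m = subst₂ (order k) (sym (opener-toℕ i (ℕ.<-trans i<j j≤m))) (sym (opener-toℕ j j≤m)) (proj₂ (related i j i<j j≤m))

        partner-increasing : ∀ i j (i<j : i < j) (j≤m : j < suc m) → toℕ (partner (opener i (ℕ.<-trans i<j j≤m))) < toℕ (partner (opener j j≤m))
        partner-increasing i j i<j j≤m = subst₂ _<_ (sym (partner-opener i (ℕ.<-trans i<j j≤m))) (sym (partner-opener j j≤m)) (increasing i j i<j j≤m)

      pattern⇒crossing : ∀ m → HasPattern crossing n encode m → MonoCrossing M m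
      pattern⇒crossing m pat = f , colour₀ , (λ a → opener-colour (toℕ a) (Fin.toℕ<n a)) ,
        (λ a b a<b → opener-pattern (toℕ a) (toℕ b) a<b (Fin.toℕ<n b)) ,
        subst₂ _<_ (sym (opener-toℕ (toℕ (fromℕ m)) (Fin.toℕ<n (fromℕ m)))) (sym (partner-opener 0 (s≤s z≤n)))
          (ℕ.<-≤-trans (proj₂ (proj₂ (in-window (toℕ (fromℕ m)) (Fin.toℕ<n (fromℕ m))))) (proj₁ (in-window 0 (s≤s z≤n)))) ,
        (λ a b a<b → partner-increasing (toℕ a) (toℕ b) a<b (Fin.toℕ<n b))
        where
        C = closers crossing m pat
        open Closers C
        open Openers C
        f : Fin (suc m) → Fin n
        f a = opener (toℕ a) (Fin.toℕ<n a)

      pattern⇒nesting : ∀ m → HasPattern nesting n encode m → MonoNesting M m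
      pattern⇒nesting m pat = f , colour₀ , (λ a → opener-colour (κ a) (κ≤m a)) ,
        (λ a b a<b → opener-pattern (κ b) (κ a) (κ-< a b a<b) (κ≤m a)) ,
        opener-< (κ (fromℕ m)) (κ≤m (fromℕ m)) ,
        (λ a b a<b → partner-increasing (κ b) (κ a) (κ-< a b a<b) (κ≤m a))
        where
        C = closers nesting m pat
        open Openers C
        κ : Fin (suc m) → ℕ
        κ a = m ∸ toℕ a
        κ≤m : ∀ a → κ a < suc m
        κ≤m a = s≤s (ℕ.m∸n≤m m (toℕ a))
        κ-< : ∀ a b → a <ᶠ b → κ b < κ a
        κ-< a b a<b = ℕ.∸-monoʳ-< a<b (ℕ.≤-pred (Fin.toℕ<n b))
        f : Fin (suc m) → Fin n
        f a = opener (κ a) (κ≤m a)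

module Words (j′ k′ r′ n : ℕ) where

  open import Data.Fin using (toℕ; fromℕ<)
  import Data.Fin.Properties as Fin
  open import Data.Vec using (Vec; lookup; tabulate)
  import Data.Vec.Properties as Vec
  open import Data.List using (List; []; length; map)
  open import Data.Maybe using (just)
  open import Data.Product using (Σ; _×_; _,_; proj₁; proj₂)
  open import Function using (_∘_)
  open import Relation.Binary.PropositionalEquality using (_≡_; refl; sym; trans; cong; cong₂)

  open Generation (suc r′)
  open Automaton (suc r′) fzero j′ k′
  open MatchingLink (suc r′)
  open Encoding using (encode)

  vec-ext : {A : Set} {k : ℕ} (xs ys : Vec A k) → (∀ i → lookup xs i ≡ lookup ys i) → xs ≡ ys
  vec-ext xs ys eq = trans (sym (Vec.tabulate∘lookup xs)) (trans (Vec.tabulate-cong eq) (Vec.tabulate∘lookup ys))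

  map≡[] : {A B : Set} {f : A → B} (xs : List A) → map f xs ≡ [] → xs ≡ []
  map≡[] [] _ = refl

  Accepted : List Letter → Set
  Accepted w = length w ≡ n × run w ≡ just []

  Encodes : ColoredMatchingData n (suc r′) → List Letter → Set
  Encodes M w = build w ≈ encode M

  noPatterns : ∀ M → NCNGood j′ k′ M → NoPatterns n (encode M)
  noPatterns M (isM , ¬crossing , ¬nesting) crossing = ¬crossing ∘ Encoding.Patterns.pattern⇒crossing M isM j′
  noPatterns M (isM , ¬crossing , ¬nesting) nesting  = ¬nesting ∘ Encoding.Patterns.pattern⇒nesting M isM k′

  good : ∀ M → IsColoredMatching M → NoPatterns n (encode M) → NCNGood j′ k′ M
  good M isM none = isM , none crossing ∘ Encoding.Patterns.crossing⇒pattern M isM j′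
                        , none nesting ∘ Encoding.Patterns.nesting⇒pattern M isM k′

  word : ∀ M → NCNGood j′ k′ M → Σ (List Letter) λ w → Accepted w × Encodes M w
  word M isGood@(isM , _) =
    let w , length≡ , run≡ , build≈ = run-complete n (encode M) (Encoding.encode-wellFormed M isM) (noPatterns M isGood)
    in w , (length≡ , run≡) , build≈

  word-unique : ∀ {M w w′} → NCNGood j′ k′ M → Accepted w → Accepted w′ → Encodes M w → Encodes M w′ → w ≡ w′
  word-unique _ (length≡ , run≡) (length≡′ , run≡′) build≈ build≈′ =
    build-injective _ _ [] [] run≡ run≡′ (trans length≡ (sym length≡′)) (≈-trans build≈ (≈-sym build≈′))

  matching-unique : ∀ {M M′ w} → NCNGood j′ k′ M → NCNGood j′ k′ M′ → Accepted w → Encodes M w → Encodes M′ w → M ≡ M′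
  matching-unique {M} {M′} _ _ _ build≈ build≈′ = cong₂ _,_
    (vec-ext _ _ (λ i → Fin.toℕ-injective (trans (sym (Encoding.σM-fin M i)) (trans (proj₁ encode≈ (toℕ i)) (Encoding.σM-fin M′ i)))))
    (vec-ext _ _ (λ i → trans (sym (Encoding.colourM-fin M i)) (trans (proj₁ (proj₂ encode≈) (toℕ i)) (Encoding.colourM-fin M′ i))))
    where encode≈ = ≈-trans (≈-sym build≈) build≈′

  matching : ∀ w → Accepted w → Σ (ColoredMatchingData n (suc r′)) λ M → NCNGood j′ k′ M × Encodes M w
  matching w (refl , run≡) = M , good M isM (λ k pat → none k (≈-HasPattern k n (bound k) encode≈ pat)) , ≈-sym encode≈
    where
    sound = run-sound w [] run≡
    wf = proj₁ sound
    none = proj₁ (proj₂ sound)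
    M : ColoredMatchingData n (suc r′)
    M = tabulate (λ i → fromℕ< (σ-< wf (toℕ i) (Fin.toℕ<n i))) , tabulate (λ i → colour (build w) (toℕ i))
    encode≈ : encode M ≈ build w
    encode≈ =
      Encoding.fin-or-beyond M (λ x → Encoding.σM M x ≡ σ (build w) x)
        (λ i → trans (Encoding.σM-fin M i) (trans (cong toℕ (Vec.lookup∘tabulate _ i)) (Fin.toℕ-fromℕ< _)))
        (λ x n≤x → trans (Encoding.σM-beyond M x n≤x) (sym (WellFormed.σ-beyond wf x n≤x))) ,
      Encoding.fin-or-beyond M (λ x → Encoding.colourM M x ≡ colour (build w) x)
        (λ i → trans (Encoding.colourM-fin M i) (Vec.lookup∘tabulate _ i))
        (λ x n≤x → trans (Encoding.colourM-beyond M x n≤x) (sym (WellFormed.colour-beyond wf x n≤x))) ,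
      sym (map≡[] (queue (build w)) (proj₂ (proj₂ sound)))
    isM : IsColoredMatching M
    isM = Encoding.isColoredMatching M (≈-wellFormed n (≈-sym encode≈) wf)

  count-accepted : ∀ {m} → IsCount (NCNGood {n} {suc r′} j′ k′) m → IsCount Accepted m
  count-accepted = Counting.Transfer.IsCount-transfer Encodes word
    (λ {M} {w} {w′} → word-unique {M} {w} {w′}) (λ {M} {M′} {w} → matching-unique {M} {M′} {w}) matching

  NCN≡accepted : ∀ {m} → IsCount (NCNGood {n} {suc r′} j′ k′) m → m ≡ length (wordsTo [] n)
  NCN≡accepted count = Counting.IsCount-unique (count-accepted count) (accepted-count n)

corollary5p4 : (j' k' r' : ℕ) (NCN : ℕ → ℕ) →
  (∀ n → IsCount (NCNGood {n} {suc r'} j' k') (NCN n)) →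
  IsRationalSeries NCN
corollary5p4 j′ k′ r′ NCN counts =
  RationalSeries.rational-congˡ (λ n → Words.NCN≡accepted j′ k′ r′ n (counts n)) (Automaton.accepted-rational (suc r′) fzero j′ k′)
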